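{- For every integer $s \geqslant 1$, the graph $K_{8s+3} - K_2$ has a quadrangular embedding in the closed orientable surface $S_{8s^2+s}$.
   Context: $K_p - K_i$ denotes the graph obtained from the complete graph $K_p$ by deleting all edges of a fixed complete subgraph $K_i$ (keeping all vertices); in particular $K_p - K_2$ is $K_p$ minus one edge. A quadrangular embedding is a 2-cell embedding in which every face has length exactly $4$. $S_h$ denotes the closed orientable surface of genus $h$. -}

module Defs where

open import Data.Nat using (ℕ; zero; suc; _+_; _*_; _<_; _≤ᵇ_; _<ᵇ_)
open import Data.Fin using (Fin; toℕ)
open import Data.Fin.Properties using (_≟_)
open import Data.Bool using (Bool; true; false; T; not; _∧_)
open import Data.Product using (_×_; _,_; Σ)
open import Data.List using (List; length; filterᵇ; and; map; upTo; allFin; cartesianProduct)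
open import Relation.Nullary using (¬_)
open import Relation.Nullary.Decidable using (⌊_⌋)
open import Relation.Binary.PropositionalEquality using (_≡_; _≢_)

iter : {A : Set} → (A → A) → ℕ → A → A
iter f zero    x = x
iter f (suc k) x = f (iter f k x)

-- K_n - K_2 : complete graph on Fin n with the single edge {0,1} removed
-- (the fixed K_2 is the one on the vertices 0 and 1).
KminusK2 : (n : ℕ) → Fin n → Fin n → Bool
KminusK2 n u v = not ⌊ u ≟ v ⌋ ∧ not ((toℕ u <ᵇ 2) ∧ (toℕ v <ᵇ 2))

module _ {n : ℕ} (adj : Fin n → Fin n → Bool) where

  Adj : Fin n → Fin n → Set
  Adj u v = T (adj u v)

  -- A rotation system: at each vertex v, a cyclic permutation (single cycle)
  -- of the neighbours of v.  (Combinatorial description of 2-cell embeddings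
  -- of a connected graph in closed orientable surfaces, Heffter–Edmonds.)
  record Rotation : Set where
    field
      rot        : Fin n → Fin n → Fin n
      rot-adj    : ∀ v u → Adj v u → Adj v (rot v u)
      rot-inj    : ∀ v u w → Adj v u → Adj v w → rot v u ≡ rot v w → u ≡ w
      rot-cyclic : ∀ v u w → Adj v u → Adj v w → Σ ℕ λ k → iter (rot v) k u ≡ w

  Dart : Set
  Dart = Fin n × Fin n

  IsDart : Dart → Set
  IsDart (u , v) = Adj u v

  darts : List Dart
  darts = filterᵇ (λ { (u , v) → adj u v }) (cartesianProduct (allFin n) (allFin n))

  numEdges : ℕ
  numEdges = length (filterᵇ (λ { (u , v) → adj u v ∧ (toℕ u <ᵇ toℕ v) })
                              (cartesianProduct (allFin n) (allFin n)))

  module _ (R : Rotation) where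
    open Rotation R

    faceStep : Dart → Dart
    faceStep (u , v) = (v , rot v u)

    code : Dart → ℕ
    code (u , v) = toℕ u * n + toℕ v

    -- a dart is the representative of its face if it has the smallest code
    -- in its faceStep-orbit
    isFaceRep : Dart → Bool
    isFaceRep d = and (map (λ k → code d ≤ᵇ code (iter faceStep k d)) (upTo (length darts)))

    numFaces : ℕ
    numFaces = length (filterᵇ isFaceRep darts)

    Quadrangular : Set
    Quadrangular = ∀ d → IsDart d →
      (iter faceStep 4 d ≡ d) × (∀ k → 0 < k → k < 4 → iter faceStep k d ≢ d)

    -- the embedding lies in the orientable surface S_h (Euler: V - E + F = 2 - 2h)
    InSurfaceOfGenus : ℕ → Set
    InSurfaceOfGenus h = n + numFaces + 2 * h ≡ 2 + numEdges

-- Take m = 8s + 1 and let the vertices of K_{8s+3} − K_2 be x = 0, y = 1 (the removed edge) and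
-- 2 + i for i ∈ ℤ_m. Every vertex 2 + i sees its neighbours in the same cyclic order ρ of
-- "directions": x, y and the nonzero currents d ∈ ℤ_m (pointing to 2 + (i + d)); x and y turn
-- their neighbours by +1 and −1. Face tracing turns a dart of current d into one of current
-- ρ(−d), and each such orbit of currents ({+(2j+3), −(2j+1), −(2j+4), +(2j+2)}, {−2, +1, x},
-- {+4s, −(4s−1), y}) has total current 0 in ℤ_m, so it closes up after four steps wherever it
-- starts: all faces are quadrilaterals. Counting darts, 4F = 2E = (8s+3)(8s+2) − 2, and Euler's
-- formula gives the genus 8s² + s.
module Submission where

open import Defs
open import Function.Base using (_∘_; id)
open import Function.Bundles using (_⇔_; mk⇔; Equivalence)
open import Data.Nat
  using (ℕ; zero; suc; _+_; _*_; _∸_; _<_; _≤_; z≤n; s≤s; _≤ᵇ_; _<ᵇ_; _≡ᵇ_; NonZero; _%_)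
open import Data.Nat.Properties hiding (_≟_)
open import Data.Nat.DivMod using (m%n<n; %-distribˡ-+; m%n%n≡m%n; [m+n]%n≡m%n; m<n⇒m%n≡m; %-remove-+ʳ; n%n≡0)
open import Data.Nat.Divisibility using (_∣_; divides)
open import Data.Nat.ListAction using (sum)
open import Data.Nat.Tactic.RingSolver using (solve-∀)
open import Data.Bool using (Bool; true; false; T; not; _∧_; if_then_else_)
open import Data.Bool.Properties using (not-involutive; T-∧; ∧-zeroʳ; ∧-comm; ∧-identityʳ)
open import Data.Bool.ListAction using (all)
open import Data.Unit using (⊤; tt)
open import Data.Fin using (Fin; toℕ; fromℕ<; combine; remQuot)
open import Data.Fin.Properties using (_≟_; toℕ-injective; toℕ-fromℕ<; toℕ<n; toℕ-combine; remQuot-combine)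
open import Data.Product using (Σ; _×_; _,_; proj₁; proj₂; swap)
open import Data.Sum using (_⊎_; inj₁; inj₂)
open import Data.List using (List; []; _∷_; _++_; length; map; upTo; tabulate; filterᵇ; cartesianProduct; allFin)
open import Data.List.Properties using (filter-++; length-++; map-tabulate; length-tabulate)
open import Data.List.Relation.Unary.All as All using (All; []; _∷_)
open import Data.List.Relation.Unary.All.Properties using (all⁺; all⁻) renaming (map⁺ to All-map⁺)
open import Data.List.Relation.Unary.Any using (here; there)
open import Data.List.Relation.Unary.AllPairs using ([]; _∷_)
open import Data.List.Relation.Unary.Unique.Propositional using (Unique)
open import Data.List.Relation.Unary.Unique.Propositional.Properties
  using (filter⁺; cartesianProduct⁺; allFin⁺; upTo⁺) renaming (map⁺ to unique-map⁺)
open import Data.List.Membership.Propositional using (_∈_)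
open import Data.List.Membership.Propositional.Properties
  using ( ∈-map⁺; ∈-map⁻; ∈-cartesianProduct⁺; ∈-cartesianProduct⁻; ∈-filter⁺; ∈-filter⁻
        ; ∈-allFin; ∈-tabulate⁻; ∈-upTo⁺)
open import Data.List.Membership.Propositional.Properties.WithK using (unique∧set⇒bag)
open import Data.List.Relation.Binary.BagAndSetEquality using (∼bag⇒↭)
open import Data.List.Relation.Binary.Permutation.Propositional using (_↭_; ↭-sym)
open import Data.List.Relation.Binary.Permutation.Propositional.Properties using (↭-length; filter-↭; ∷↭∷ʳ)
open import Relation.Binary.PropositionalEquality
open import Relation.Binary.Definitions using (DecidableEquality; tri<; tri≈; tri>)
open import Relation.Nullary using (contradiction; yes; no)
open import Relation.Nullary.Decidable using (⌊_⌋; dec-true; dec-false; toWitness; fromWitness; fromWitnessFalse)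
open import Relation.Nullary.Decidable.Core using (T?)

≤ᵇ-true : ∀ {a b} → a ≤ b → (a ≤ᵇ b) ≡ true
≤ᵇ-true {a} {b} a≤b = dec-true (T? (a ≤ᵇ b)) (≤⇒≤ᵇ a≤b)

≤ᵇ-false : ∀ {a b} → b < a → (a ≤ᵇ b) ≡ false
≤ᵇ-false {a} {b} b<a = dec-false (T? (a ≤ᵇ b)) (λ a≤b → <⇒≱ b<a (≤ᵇ⇒≤ a b a≤b))

≡ᵇ-refl : ∀ n → (n ≡ᵇ n) ≡ true
≡ᵇ-refl n = dec-true (T? (n ≡ᵇ n)) (≡⇒≡ᵇ n n refl)

≡ᵇ-false : ∀ {a b} → a ≢ b → (a ≡ᵇ b) ≡ false
≡ᵇ-false {a} {b} a≢b = dec-false (T? (a ≡ᵇ b)) (a≢b ∘ ≡ᵇ⇒≡ a b)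

T-ext : ∀ {a b} → (T a → T b) → (T b → T a) → a ≡ b
T-ext {false} {false} _ _ = refl
T-ext {false} {true}  _ g = contradiction tt g
T-ext {true}  {false} f _ = contradiction tt f
T-ext {true}  {true}  _ _ = refl

module _ {A : Set} (f : A → A) where

  iter-+ : ∀ a b x → iter f (a + b) x ≡ iter f a (iter f b x)
  iter-+ zero    b x = refl
  iter-+ (suc a) b x = cong f (iter-+ a b x)

  iter-suc : ∀ k x → iter f (suc k) x ≡ iter f k (f x)
  iter-suc k x = trans (cong (λ j → iter f j x) (+-comm 1 k)) (iter-+ k 1 x)

  iter-*-fixed : ∀ {p x} → iter f p x ≡ x → ∀ k → iter f (k * p) x ≡ x
  iter-*-fixed         fixed zero    = refl
  iter-*-fixed {p} {x} fixed (suc k) = begin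
    iter f (p + k * p) x         ≡⟨ iter-+ p (k * p) x ⟩
    iter f p (iter f (k * p) x)  ≡⟨ cong (iter f p) (iter-*-fixed fixed k) ⟩
    iter f p x                   ≡⟨ fixed ⟩
    x                            ∎
    where open ≡-Reasoning

  Reaches : A → A → Set
  Reaches x y = Σ ℕ λ k → iter f k x ≡ y

  ExactPeriod : ℕ → A → Set
  ExactPeriod p x = (iter f p x ≡ x) × (∀ k → 0 < k → k < p → iter f k x ≢ x)

  reaches-refl : ∀ {x} → Reaches x x
  reaches-refl = 0 , refl

  reaches-step : ∀ {x y z} → Reaches x y → f y ≡ z → Reaches x z
  reaches-step (k , x⇝y) fy≡z = suc k , trans (cong f x⇝y) fy≡z

  reaches-trans : ∀ {x y z} → Reaches x y → Reaches y z → Reaches x z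
  reaches-trans {x} (k , x⇝y) (l , y⇝z) = l + k , trans (iter-+ l k x) (trans (cong (iter f l) x⇝y) y⇝z)

  -- f^(j·q) (f^j x) = f^(j·(q+1)) x = x.
  reaches-back : ∀ {q x y} → iter f (suc q) x ≡ x → Reaches x y → Reaches y x
  reaches-back {q} {x} cycle (j , refl) = j * q , (begin
    iter f (j * q) (iter f j x)  ≡⟨ iter-+ (j * q) j x ⟨
    iter f (j * q + j) x         ≡⟨ cong (λ k → iter f k x) (trans (+-comm (j * q) j) (sym (*-suc j q))) ⟩
    iter f (j * suc q) x         ≡⟨ iter-*-fixed cycle j ⟩
    x                            ∎)
    where open ≡-Reasoning

  reaches-descending : (c : ℕ → A) → (∀ j → f (c (suc j)) ≡ c j) → ∀ {j k} → j ≤ k → Reaches (c k) (c j)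
  reaches-descending c down {j} {k} j≤k = subst (λ k → Reaches (c k) (c j)) (m∸n+n≡m j≤k) (descend (k ∸ j))
    where
      descend : ∀ d → Reaches (c (d + j)) (c j)
      descend zero    = reaches-refl
      descend (suc d) = reaches-trans (1 , down (d + j)) (descend d)

  reaches-alternating : ∀ {K} (c : Bool → ℕ → A) → (∀ b j → j < K → f (c b j) ≡ c (not b) (suc j)) →
                        ∀ b {j} → j ≤ K → Reaches (c b 0) (c (iter not j b) j)
  reaches-alternating c up b {zero}  _   = reaches-refl
  reaches-alternating c up b {suc j} j<K =
    reaches-step (reaches-alternating c up b (<⇒≤ j<K)) (up (iter not j b) j j<K)

  cycle4⇒exactPeriod4 : ∀ {x₀ x₁ x₂ x₃} → f x₀ ≡ x₁ → f x₁ ≡ x₂ → f x₂ ≡ x₃ → f x₃ ≡ x₀ →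
                        x₁ ≢ x₀ → x₂ ≢ x₀ → x₃ ≢ x₀ → ExactPeriod 4 x₀
  cycle4⇒exactPeriod4 refl refl refl closes x₁≢x₀ x₂≢x₀ x₃≢x₀ = closes , distinct
    where
      distinct : ∀ k → 0 < k → k < 4 → iter f k _ ≢ _
      distinct 1 _ _ = x₁≢x₀
      distinct 2 _ _ = x₂≢x₀
      distinct 3 _ _ = x₃≢x₀
      distinct (suc (suc (suc (suc _)))) _ (s≤s (s≤s (s≤s (s≤s ()))))

  exactPeriod-distinct : ∀ {p x i j} → ExactPeriod p x → i < j → j < p → iter f i x ≢ iter f j x
  exactPeriod-distinct {p} {x} {i} {j} (back , distinct) i<j j<p eq =
    distinct (p ∸ j + i) (≤-trans (m<n⇒0<n∸m j<p) (m≤m+n (p ∸ j) i)) shorter returns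
    where
      shorter : p ∸ j + i < p
      shorter = subst (p ∸ j + i <_) (m∸n+n≡m (<⇒≤ j<p)) (+-monoʳ-< (p ∸ j) i<j)
      returns : iter f (p ∸ j + i) x ≡ x
      returns = begin
        iter f (p ∸ j + i) x         ≡⟨ iter-+ (p ∸ j) i x ⟩
        iter f (p ∸ j) (iter f i x)  ≡⟨ cong (iter f (p ∸ j)) eq ⟩
        iter f (p ∸ j) (iter f j x)  ≡⟨ iter-+ (p ∸ j) j x ⟨
        iter f (p ∸ j + j) x         ≡⟨ cong (λ k → iter f k x) (m∸n+n≡m (<⇒≤ j<p)) ⟩
        iter f p x                   ≡⟨ back ⟩
        x                            ∎
        where open ≡-Reasoning

reaches-inverse : ∀ {A : Set} {f g : A → A} (P : A → Set) →
                  (∀ {x} → P x → P (f x)) → (∀ {x} → P x → g (f x) ≡ x) →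
                  ∀ {x y} → P x → Reaches f x y → Reaches g y x
reaches-inverse {f = f} {g} P keep undo Px (k , refl) = k , undo-iter k Px
  where
    undo-iter : ∀ k {x} → P x → iter g k (iter f k x) ≡ x
    undo-iter zero    _  = refl
    undo-iter (suc k) {x} Px = begin
      iter g (suc k) (iter f (suc k) x)  ≡⟨ cong (iter g (suc k)) (iter-suc f k x) ⟩
      g (iter g k (iter f k (f x)))      ≡⟨ cong g (undo-iter k (keep Px)) ⟩
      g (f x)                            ≡⟨ undo Px ⟩
      x                                  ∎
      where open ≡-Reasoning

iter-not-twice : ∀ j b → iter not j (iter not j b) ≡ b
iter-not-twice j b = begin
  iter not j (iter not j b)  ≡⟨ iter-+ not j j b ⟨
  iter not (j + j) b         ≡⟨ cong (λ k → iter not k b) (trans (cong (j +_) (sym (+-identityʳ j))) (*-comm 2 j)) ⟩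
  iter not (j * 2) b         ≡⟨ iter-*-fixed not (not-involutive b) j ⟩
  b                          ∎
  where open ≡-Reasoning

module Conjugation {A B : Set} {f : A → A} {g : B → B} (h : A → B) (P : A → Set)
                   (P-step : ∀ {x} → P x → P (f x)) (h-step : ∀ {x} → P x → h (f x) ≡ g (h x)) where

  h-iter : ∀ k {x} → P x → h (iter f k x) ≡ iter g k (h x)
  h-iter zero    _  = refl
  h-iter (suc k) Px = trans (h-step (P-iter k Px)) (cong g (h-iter k Px))
    where
      P-iter : ∀ k {x} → P x → P (iter f k x)
      P-iter zero    Px = Px
      P-iter (suc k) Px = P-step (P-iter k Px)

  reaches-map : ∀ {x y} → P x → Reaches f x y → Reaches g (h x) (h y)
  reaches-map Px (k , refl) = k , sym (h-iter k Px)

  exactPeriod-reflect : (∀ {x y} → h x ≡ h y → x ≡ y) →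
                        ∀ {p x} → P x → ExactPeriod g p (h x) → ExactPeriod f p x
  exactPeriod-reflect h-inj {p} {x} Px (back , distinct) =
    h-inj (trans (h-iter p Px) back) , λ k 0<k k<p eq → distinct k 0<k k<p (trans (sym (h-iter k Px)) (cong h eq))

-- Arithmetic modulo m

module Modular (m : ℕ) .{{_ : NonZero m}} where

  infixl 6 _⊕_ _⊖_

  _⊕_ : ℕ → ℕ → ℕ
  i ⊕ v = (i + v) % m

  _⊖_ : ℕ → ℕ → ℕ
  j ⊖ i = j ⊕ (m ∸ i)

  ⊕-< : ∀ i v → i ⊕ v < m
  ⊕-< i v = m%n<n (i + v) m

  %-absorbˡ : ∀ x y → (x % m + y) % m ≡ (x + y) % m
  %-absorbˡ x y = begin
    (x % m + y) % m          ≡⟨ %-distribˡ-+ (x % m) y m ⟩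
    (x % m % m + y % m) % m  ≡⟨ cong (λ z → (z + y % m) % m) (m%n%n≡m%n x m) ⟩
    (x % m + y % m) % m      ≡⟨ %-distribˡ-+ x y m ⟨
    (x + y) % m              ∎
    where open ≡-Reasoning

  %-absorbʳ : ∀ x y → (x + y % m) % m ≡ (x + y) % m
  %-absorbʳ x y = trans (cong (_% m) (+-comm x (y % m))) (trans (%-absorbˡ y x) (cong (_% m) (+-comm y x)))

  ⊕-assoc : ∀ i a b → (i ⊕ a) ⊕ b ≡ i ⊕ (a + b)
  ⊕-assoc i a b = trans (%-absorbˡ (i + a) b) (cong (_% m) (+-assoc i a b))

  ⊕-multiple : ∀ {i v} → i < m → m ∣ v → i ⊕ v ≡ i
  ⊕-multiple {i} i<m m∣v = trans (%-remove-+ʳ i m∣v) (m<n⇒m%n≡m i<m)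

  ⊕-closes : ∀ {i a b c} → i < m → m ∣ a + b + c → ((i ⊕ a) ⊕ b) ⊕ c ≡ i
  ⊕-closes {i} {a} {b} {c} i<m m∣ =
    trans (cong (_⊕ c) (⊕-assoc i a b)) (trans (⊕-assoc i (a + b) c) (⊕-multiple i<m m∣))

  ∣-rotate : ∀ a b c → m ∣ a + b + c → m ∣ b + c + a
  ∣-rotate a b c = subst (m ∣_) (rotation a b c)
    where rotation : ∀ a b c → a + b + c ≡ b + c + a
          rotation = solve-∀

  ∣-rotate4 : ∀ a b c d → m ∣ a + b + c + d → m ∣ b + c + d + a
  ∣-rotate4 a b c d = subst (m ∣_) (rotation a b c d)
    where rotation : ∀ a b c d → a + b + c + d ≡ b + c + d + a
          rotation = solve-∀

  private
    cancel : ∀ {i v} → i ≤ m → v < m → (i + (v + (m ∸ i))) % m ≡ v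
    cancel {i} {v} i≤m v<m = begin
      (i + (v + (m ∸ i))) % m  ≡⟨ cong (_% m) (exchange i v (m ∸ i)) ⟩
      (v + (i + (m ∸ i))) % m  ≡⟨ cong (λ k → (v + k) % m) (m+[n∸m]≡n i≤m) ⟩
      (v + m) % m              ≡⟨ [m+n]%n≡m%n v m ⟩
      v % m                    ≡⟨ m<n⇒m%n≡m v<m ⟩
      v                        ∎
      where
        open ≡-Reasoning
        exchange : ∀ a b c → a + (b + c) ≡ b + (a + c)
        exchange = solve-∀

  ⊖-⊕ : ∀ {i v} → i < m → v < m → (i ⊕ v) ⊖ i ≡ v
  ⊖-⊕ {i} {v} i<m v<m = trans (⊕-assoc i v (m ∸ i)) (cancel (<⇒≤ i<m) v<m)

  ⊕-⊖ : ∀ {i j} → i < m → j < m → i ⊕ (j ⊖ i) ≡ j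
  ⊕-⊖ {i} {j} i<m j<m = trans (%-absorbʳ i (j + (m ∸ i))) (cancel (<⇒≤ i<m) j<m)

  ⊖-self : ∀ {i} → i < m → i ⊖ i ≡ 0
  ⊖-self {i} i<m = trans (cong (_% m) (m+[n∸m]≡n (<⇒≤ i<m))) (n%n≡0 m)

  ⊕-undo : ∀ {i v} → i < m → v ≤ m → (i ⊕ v) ⊕ (m ∸ v) ≡ i
  ⊕-undo {i} {v} i<m v≤m = trans (⊕-assoc i v (m ∸ v))
    (trans (cong (λ k → (i + k) % m) (m+[n∸m]≡n v≤m)) (trans ([m+n]%n≡m%n i m) (m<n⇒m%n≡m i<m)))

  ⊕-cancelʳ : ∀ {i j v} → i < m → j < m → v ≤ m → i ⊕ v ≡ j ⊕ v → i ≡ j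
  ⊕-cancelʳ {i} {j} {v} i<m j<m v≤m eq =
    trans (sym (⊕-undo i<m v≤m)) (trans (cong (_⊕ (m ∸ v)) eq) (⊕-undo j<m v≤m))

  ⊖-⊕-reverse : ∀ {i v} → i < m → 0 < v → v ≤ m → i ⊖ (i ⊕ v) ≡ m ∸ v
  ⊖-⊕-reverse {i} {v} i<m 0<v v≤m = begin
    i ⊖ (i ⊕ v)                    ≡⟨ cong (_⊖ (i ⊕ v)) (⊕-undo i<m v≤m) ⟨
    ((i ⊕ v) ⊕ (m ∸ v)) ⊖ (i ⊕ v)  ≡⟨ ⊖-⊕ (⊕-< i v) (∸-monoʳ-< 0<v v≤m) ⟩
    m ∸ v                          ∎
    where open ≡-Reasoning

  ⊕-≢ : ∀ {i v} → i < m → 0 < v → v < m → i ⊕ v ≢ i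
  ⊕-≢ {i} {v} i<m 0<v v<m eq = <⇒≢ 0<v (sym (begin
    v            ≡⟨ ⊖-⊕ i<m v<m ⟨
    (i ⊕ v) ⊖ i  ≡⟨ cong (_⊖ i) eq ⟩
    i ⊖ i        ≡⟨ ⊖-self i<m ⟩
    0            ∎))
    where open ≡-Reasoning

  ⊖-nonzero : ∀ {i j} → i < m → j < m → j ≢ i → 0 < j ⊖ i
  ⊖-nonzero {i} {j} i<m j<m j≢i with j ⊖ i in eq
  ... | suc _ = s≤s z≤n
  ... | zero  = contradiction (trans (sym (⊕-⊖ i<m j<m)) (trans (cong (i ⊕_) eq) (⊕-multiple i<m (divides 0 refl))))
                              j≢i

  iter-⊕1 : ∀ {j} → j < m → ∀ q → iter (_⊕ 1) q j ≡ j ⊕ q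
  iter-⊕1 {j} j<m zero    = sym (⊕-multiple j<m (divides 0 refl))
  iter-⊕1 {j} j<m (suc q) = trans (cong (_⊕ 1) (iter-⊕1 j<m q)) (trans (⊕-assoc j q 1) (cong (j ⊕_) (+-comm q 1)))

  reaches-⊕1 : ∀ {j k} → j < m → k < m → Reaches (_⊕ 1) j k
  reaches-⊕1 {j} {k} j<m k<m = k ⊖ j , trans (iter-⊕1 j<m (k ⊖ j)) (⊕-⊖ j<m k<m)

module _ {A : Set} where

  count : (A → Bool) → List A → ℕ
  count p xs = length (filterᵇ p xs)

  count-++ : ∀ p xs ys → count p (xs ++ ys) ≡ count p xs + count p ys
  count-++ p xs ys = trans (cong length (filter-++ (T? ∘ p) xs ys)) (length-++ (filterᵇ p xs))

  count-↭ : ∀ p {xs ys} → xs ↭ ys → count p xs ≡ count p ys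
  count-↭ p xs↭ys = ↭-length (filter-↭ (T? ∘ p) xs↭ys)

  count-cong : ∀ {p q} → (∀ x → p x ≡ q x) → ∀ xs → count p xs ≡ count q xs
  count-cong         p≗q []       = refl
  count-cong {p} {q} p≗q (x ∷ xs) with p x | q x | p≗q x
  ... | true  | true  | refl = cong suc (count-cong p≗q xs)
  ... | false | false | refl = count-cong p≗q xs

  count-all : ∀ {p xs} → All (T ∘ p) xs → count p xs ≡ length xs
  count-all             []         = refl
  count-all {p} {x ∷ _} (px ∷ pxs) with p x
  ... | true = cong suc (count-all pxs)

  count-split : ∀ (p q : A → Bool) xs →
                count p xs ≡ count (λ x → p x ∧ q x) xs + count (λ x → p x ∧ not (q x)) xs
  count-split p q []       = refl
  count-split p q (x ∷ xs) with p x | q x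
  ... | true  | true  = cong suc (count-split p q xs)
  ... | true  | false = trans (cong suc (count-split p q xs)) (sym (+-suc _ _))
  ... | false | _     = count-split p q xs

  count-≢ : (_≟ᴬ_ : DecidableEquality A) → ∀ {u xs} → Unique xs → u ∈ xs →
            suc (count (λ v → not ⌊ u ≟ᴬ v ⌋) xs) ≡ length xs
  count-≢ _≟ᴬ_ {u} (u∉ ∷ _) (here refl) with u ≟ᴬ u
  ... | yes _   = cong suc (count-all (All.map fromWitnessFalse u∉))
  ... | no u≢u  = contradiction refl u≢u
  count-≢ _≟ᴬ_ {u} {x ∷ _} (x∉ ∷ xs!) (there u∈) with u ≟ᴬ x
  ... | no _     = cong suc (count-≢ _≟ᴬ_ xs! u∈)
  ... | yes refl = contradiction refl (All.lookup x∉ u∈)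

  sum-map-const : ∀ {g : A → ℕ} {c} xs → (∀ {x} → x ∈ xs → g x ≡ c) → sum (map g xs) ≡ length xs * c
  sum-map-const []       g≡c = refl
  sum-map-const (x ∷ xs) g≡c = cong₂ _+_ (g≡c (here refl)) (sum-map-const xs (g≡c ∘ there))

  unique-map-local : ∀ {g : A → A} {xs} → (∀ {x y} → x ∈ xs → y ∈ xs → g x ≡ g y → x ≡ y) →
                     Unique xs → Unique (map g xs)
  unique-map-local {xs = []}     inj []         = []
  unique-map-local {xs = x ∷ xs} inj (x∉ ∷ xs!) =
    All-map⁺ (All.tabulate λ y∈ gx≡gy → All.lookup x∉ y∈ (inj (here refl) (there y∈) gx≡gy))
    ∷ unique-map-local (λ x∈ y∈ → inj (there x∈) (there y∈)) xs!

  unique∧same⇒↭ : ∀ {xs ys} → Unique xs → Unique ys → (∀ {z} → z ∈ xs ⇔ z ∈ ys) → xs ↭ ys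
  unique∧same⇒↭ xs! ys! same = ∼bag⇒↭ {A = A} (unique∧set⇒bag xs! ys! same)

module _ {A B : Set} where

  count-map : ∀ (p : B → Bool) (f : A → B) xs → count p (map f xs) ≡ count (p ∘ f) xs
  count-map p f []       = refl
  count-map p f (x ∷ xs) with p (f x)
  ... | true  = cong suc (count-map p f xs)
  ... | false = count-map p f xs

count-tabulate : ∀ {A : Set} {k} (p : A → Bool) (g : Fin k → A) → count p (tabulate g) ≡ count (p ∘ g) (allFin k)
count-tabulate p g = trans (cong (count p) (sym (map-tabulate id g))) (count-map p g (allFin _))

module _ {A B : Set} where

  count-cartesianProduct : ∀ (p : A × B → Bool) xs ys →
    count p (cartesianProduct xs ys) ≡ sum (map (λ x → count (λ y → p (x , y)) ys) xs)
  count-cartesianProduct p []       ys = refl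
  count-cartesianProduct p (x ∷ xs) ys = trans (count-++ p (map (x ,_) ys) (cartesianProduct xs ys))
    (cong₂ _+_ (count-map p (x ,_) ys) (count-cartesianProduct p xs ys))

  count-swap : ∀ (p : A × B → Bool) {xs ys} → Unique xs → Unique ys →
               count p (cartesianProduct xs ys) ≡ count (p ∘ swap) (cartesianProduct ys xs)
  count-swap p {xs} {ys} xs! ys! =
    trans (count-↭ p (unique∧same⇒↭ (cartesianProduct⁺ xs! ys!) swapped! (mk⇔ to from)))
          (count-map p swap (cartesianProduct ys xs))
    where
      swapped! : Unique (map swap (cartesianProduct ys xs))
      swapped! = unique-map⁺ (cong swap) (cartesianProduct⁺ ys! xs!)
      to : ∀ {z} → z ∈ cartesianProduct xs ys → z ∈ map swap (cartesianProduct ys xs)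
      to z∈ = let x∈ , y∈ = ∈-cartesianProduct⁻ xs ys z∈ in ∈-map⁺ swap (∈-cartesianProduct⁺ y∈ x∈)
      from : ∀ {z} → z ∈ map swap (cartesianProduct ys xs) → z ∈ cartesianProduct xs ys
      from z∈ with ∈-map⁻ swap z∈
      ... | _ , yx∈ , refl = let y∈ , x∈ = ∈-cartesianProduct⁻ ys xs yx∈ in ∈-cartesianProduct⁺ x∈ y∈

module _ {A : Set} {f : A → A} {q : ℕ} {xs : List A} (xs! : Unique xs)
         (closed : ∀ {x} → x ∈ xs → f x ∈ xs) (cycle : ∀ {x} → x ∈ xs → iter f (suc q) x ≡ x) where

  iter-closed : ∀ k {x} → x ∈ xs → iter f k x ∈ xs
  iter-closed zero    x∈ = x∈
  iter-closed (suc k) x∈ = closed (iter-closed k x∈)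

  iter-inverseˡ : ∀ k {x} → x ∈ xs → iter f (k * q) (iter f k x) ≡ x
  iter-inverseˡ k {x} x∈ = trans (sym (iter-+ f (k * q) k x))
    (trans (cong (λ j → iter f j x) (trans (+-comm (k * q) k) (sym (*-suc k q)))) (iter-*-fixed f (cycle x∈) k))

  iter-inverseʳ : ∀ k {x} → x ∈ xs → iter f k (iter f (k * q) x) ≡ x
  iter-inverseʳ k {x} x∈ = trans (sym (iter-+ f k (k * q) x))
    (trans (cong (λ j → iter f j x) (sym (*-suc k q))) (iter-*-fixed f (cycle x∈) k))

  map-iter-↭ : ∀ k → map (iter f k) xs ↭ xs
  map-iter-↭ k = unique∧same⇒↭ (unique-map-local injective xs!) xs! (mk⇔ into onto)
    where
      injective : ∀ {x y} → x ∈ xs → y ∈ xs → iter f k x ≡ iter f k y → x ≡ y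
      injective x∈ y∈ eq = trans (sym (iter-inverseˡ k x∈)) (trans (cong (iter f (k * q)) eq) (iter-inverseˡ k y∈))
      into : ∀ {z} → z ∈ map (iter f k) xs → z ∈ xs
      into z∈ with ∈-map⁻ (iter f k) z∈
      ... | _ , x∈ , refl = iter-closed k x∈
      onto : ∀ {z} → z ∈ xs → z ∈ map (iter f k) xs
      onto z∈ = subst (_∈ map (iter f k) xs) (iter-inverseʳ k z∈) (∈-map⁺ (iter f k) (iter-closed (k * q) z∈))

-- One representative per face

isMinOf : ℕ → ℕ → ℕ → ℕ → Bool
isMinOf a b c d = (a ≤ᵇ b) ∧ ((a ≤ᵇ c) ∧ (a ≤ᵇ d))

cyclicMinima : ℕ → ℕ → ℕ → ℕ → List Bool
cyclicMinima a b c d = isMinOf a b c d ∷ isMinOf b c d a ∷ isMinOf c d a b ∷ isMinOf d a b c ∷ []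

count-cyclicMinima-rotate : ∀ a b c d → count id (cyclicMinima b c d a) ≡ count id (cyclicMinima a b c d)
count-cyclicMinima-rotate a b c d = count-↭ id (↭-sym (∷↭∷ʳ (isMinOf a b c d) _))

count-cyclicMinima-first : ∀ {a b c d} → a < b → a < c → a < d → count id (cyclicMinima a b c d) ≡ 1
count-cyclicMinima-first {a} {b} {c} {d} a<b a<c a<d
  rewrite ≤ᵇ-true (<⇒≤ a<b) | ≤ᵇ-true (<⇒≤ a<c) | ≤ᵇ-true (<⇒≤ a<d)
        | ≤ᵇ-false a<b | ≤ᵇ-false a<c | ≤ᵇ-false a<d
        | ∧-zeroʳ (b ≤ᵇ d) | ∧-zeroʳ (b ≤ᵇ c) | ∧-zeroʳ (c ≤ᵇ d) = refl

count-cyclicMinima : ∀ {a b c d} → a ≢ b → a ≢ c → a ≢ d → b ≢ c → b ≢ d → c ≢ d →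
                     count id (cyclicMinima a b c d) ≡ 1
count-cyclicMinima {a} {b} {c} {d} a≢b a≢c a≢d b≢c b≢d c≢d = go (compare a≢b) (compare c≢d)
  where
    compare : ∀ {x y} → x ≢ y → x < y ⊎ y < x
    compare {x} {y} x≢y with <-cmp x y
    ... | tri< x<y _ _ = inj₁ x<y
    ... | tri≈ _ x≡y _ = contradiction x≡y x≢y
    ... | tri> _ _ y<x = inj₂ y<x
    minimum-a : a < b → a < c → a < d → count id (cyclicMinima a b c d) ≡ 1
    minimum-a = count-cyclicMinima-first
    minimum-b : b < c → b < d → b < a → count id (cyclicMinima a b c d) ≡ 1
    minimum-b b<c b<d b<a = trans (sym (count-cyclicMinima-rotate a b c d)) (count-cyclicMinima-first b<c b<d b<a)
    minimum-c : c < d → c < a → c < b → count id (cyclicMinima a b c d) ≡ 1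
    minimum-c c<d c<a c<b = trans (sym (count-cyclicMinima-rotate a b c d))
      (trans (sym (count-cyclicMinima-rotate b c d a)) (count-cyclicMinima-first c<d c<a c<b))
    minimum-d : d < a → d < b → d < c → count id (cyclicMinima a b c d) ≡ 1
    minimum-d d<a d<b d<c = trans (sym (count-cyclicMinima-rotate a b c d))
      (trans (sym (count-cyclicMinima-rotate b c d a))
        (trans (sym (count-cyclicMinima-rotate c d a b)) (count-cyclicMinima-first d<a d<b d<c)))
    go : a < b ⊎ b < a → c < d ⊎ d < c → count id (cyclicMinima a b c d) ≡ 1
    go (inj₁ a<b) (inj₁ c<d) with compare a≢c
    ... | inj₁ a<c = minimum-a a<b a<c (<-trans a<c c<d)
    ... | inj₂ c<a = minimum-c c<d c<a (<-trans c<a a<b)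
    go (inj₁ a<b) (inj₂ d<c) with compare a≢d
    ... | inj₁ a<d = minimum-a a<b (<-trans a<d d<c) a<d
    ... | inj₂ d<a = minimum-d d<a (<-trans d<a a<b) d<c
    go (inj₂ b<a) (inj₁ c<d) with compare b≢c
    ... | inj₁ b<c = minimum-b b<c (<-trans b<c c<d) b<a
    ... | inj₂ c<b = minimum-c c<d (<-trans c<b b<a) c<b
    go (inj₂ b<a) (inj₂ d<c) with compare b≢d
    ... | inj₁ b<d = minimum-b (<-trans b<d d<c) b<d b<a
    ... | inj₂ d<b = minimum-d (<-trans d<b b<a) d<b d<c

module Representatives {A : Set} (f : A → A) (code : A → ℕ) (code-inj : ∀ {x y} → code x ≡ code y → x ≡ y)
                       (N : ℕ) (4≤N : 4 ≤ N) where

  isRep : A → Bool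
  isRep d = all (λ k → code d ≤ᵇ code (iter f k d)) (upTo N)

  isRep-period4 : ∀ {d} → iter f 4 d ≡ d →
                  isRep d ≡ isMinOf (code d) (code (f d)) (code (f (f d))) (code (f (f (f d))))
  isRep-period4 {d} back = T-ext to from
    where
      below : ℕ → Bool
      below k = code d ≤ᵇ code (iter f k d)
      at : ∀ {k} → T (isRep d) → k < N → T (below k)
      at rep k<N = All.lookup (all⁺ below (upTo N) rep) (∈-upTo⁺ k<N)
      to : T (isRep d) → T (below 1 ∧ (below 2 ∧ below 3))
      to rep = Equivalence.from (T-∧ {below 1}) (at rep (≤-trans (s≤s (s≤s z≤n)) 4≤N) ,
               Equivalence.from (T-∧ {below 2}) (at rep (≤-trans (s≤s (s≤s (s≤s z≤n))) 4≤N) , at rep 4≤N))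
      from : T (below 1 ∧ (below 2 ∧ below 3)) → T (isRep d)
      from min = all⁻ below {upTo N} (All.tabulate λ {k} _ → everywhere k)
        where
          b₁ = proj₁ (Equivalence.to (T-∧ {below 1}) min)
          b₂₃ = Equivalence.to (T-∧ {below 2}) (proj₂ (Equivalence.to (T-∧ {below 1}) min))
          everywhere : ∀ k → T (below k)
          everywhere 0 = ≤⇒≤ᵇ (≤-refl {code d})
          everywhere 1 = b₁
          everywhere 2 = proj₁ b₂₃
          everywhere 3 = proj₂ b₂₃
          everywhere (suc (suc (suc (suc k)))) =
            subst (λ y → T (code d ≤ᵇ code y))
              (sym (trans (trans (cong (λ j → iter f j d) (+-comm 4 k)) (iter-+ f k 4 d)) (cong (iter f k) back)))
              (everywhere k)

  one-isRep-per-orbit : ∀ {d} → ExactPeriod f 4 d → count (λ k → isRep (iter f k d)) (upTo 4) ≡ 1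
  one-isRep-per-orbit {d} period@(back , _) = begin
    count (λ k → isRep (iter f k d)) (upTo 4)           ≡⟨ count-map id (λ k → isRep (iter f k d)) (upTo 4) ⟨
    count id (map (λ k → isRep (iter f k d)) (upTo 4))  ≡⟨ cong (count id) rotations ⟩
    count id (cyclicMinima c₀ c₁ c₂ c₃)                 ≡⟨ count-cyclicMinima (distinct 0 1) (distinct 0 2)
                                                             (distinct 0 3) (distinct 1 2) (distinct 1 3) (distinct 2 3) ⟩
    1                                                   ∎
    where
      open ≡-Reasoning
      c₀ = code d
      c₁ = code (f d)
      c₂ = code (f (f d))
      c₃ = code (f (f (f d)))
      distinct : ∀ i j → {T (i <ᵇ j)} → {T (j <ᵇ 4)} → code (iter f i d) ≢ code (iter f j d)
      distinct i j {i<j} {j<4} = exactPeriod-distinct f period (<ᵇ⇒< i j i<j) (<ᵇ⇒< j 4 j<4) ∘ code-inj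
      rotations : map (λ k → isRep (iter f k d)) (upTo 4) ≡ cyclicMinima c₀ c₁ c₂ c₃
      rotations = cong₂ _∷_ (isRep-period4 back)
        (cong₂ _∷_ (trans (isRep-period4 (cong f back)) (cong (λ y → isMinOf c₁ c₂ c₃ (code y)) back))
        (cong₂ _∷_ (trans (isRep-period4 (cong (λ y → f (f y)) back))
                          (cong (λ y → isMinOf c₂ c₃ (code y) (code (f y))) back))
        (cong₂ _∷_ (trans (isRep-period4 (cong (λ y → f (f (f y))) back))
                          (cong (λ y → isMinOf c₃ (code y) (code (f y)) (code (f (f y)))) back))
        refl)))

  -- Count the pairs (x , k) with f^k x a representative, once by x and once by k.
  4*count-isRep≡length : ∀ {xs} → Unique xs → (∀ {x} → x ∈ xs → f x ∈ xs) →
                         (∀ {x} → x ∈ xs → ExactPeriod f 4 x) → 4 * count isRep xs ≡ length xs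
  4*count-isRep≡length {xs} xs! closed quadrangular = begin
    4 * count isRep xs
      ≡⟨ sum-map-const (upTo 4) (λ {k} _ → count-shift k) ⟨
    sum (map (λ k → count (λ x → isRep (iter f k x)) xs) (upTo 4))
      ≡⟨ count-cartesianProduct (λ (k , x) → isRep (iter f k x)) (upTo 4) xs ⟨
    count (λ (k , x) → isRep (iter f k x)) (cartesianProduct (upTo 4) xs)
      ≡⟨ count-swap (λ (k , x) → isRep (iter f k x)) (upTo⁺ 4) xs! ⟩
    count (λ (x , k) → isRep (iter f k x)) (cartesianProduct xs (upTo 4))
      ≡⟨ count-cartesianProduct (λ (x , k) → isRep (iter f k x)) xs (upTo 4) ⟩
    sum (map (λ x → count (λ k → isRep (iter f k x)) (upTo 4)) xs)
      ≡⟨ sum-map-const xs (λ x∈ → one-isRep-per-orbit (quadrangular x∈)) ⟩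
    length xs * 1
      ≡⟨ *-identityʳ (length xs) ⟩
    length xs
      ∎
    where
      open ≡-Reasoning
      count-shift : ∀ k → count (λ x → isRep (iter f k x)) xs ≡ count isRep xs
      count-shift k = trans (sym (count-map isRep (iter f k) xs))
                            (count-↭ isRep (map-iter-↭ {q = 3} xs! closed (proj₁ ∘ quadrangular) k))

module _ {n : ℕ} (adj : Fin n → Fin n → Bool) where

  private
    isDart? = T? ∘ λ ((u , v) : Dart adj) → adj u v

  darts-unique : Unique (darts adj)
  darts-unique = filter⁺ isDart? (cartesianProduct⁺ (allFin⁺ n) (allFin⁺ n))

  ∈-darts⁺ : ∀ {d} → IsDart adj d → d ∈ darts adj
  ∈-darts⁺ {u , v} uv = ∈-filter⁺ isDart? (∈-cartesianProduct⁺ (∈-allFin u) (∈-allFin v)) uv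

  ∈-darts⁻ : ∀ {d} → d ∈ darts adj → IsDart adj d
  ∈-darts⁻ d∈ = proj₂ (∈-filter⁻ isDart? {xs = cartesianProduct (allFin n) (allFin n)} d∈)

  code-injective : ∀ (R : Rotation adj) {d e} → code adj R d ≡ code adj R e → d ≡ e
  code-injective R {u , v} {u′ , v′} eq = begin
    (u , v)                     ≡⟨ remQuot-combine u v ⟨
    remQuot n (combine u v)     ≡⟨ cong (remQuot n) (toℕ-injective combined) ⟩
    remQuot n (combine u′ v′)   ≡⟨ remQuot-combine u′ v′ ⟩
    (u′ , v′)                   ∎
    where
      open ≡-Reasoning
      toℕ-combine′ : ∀ (a b : Fin n) → toℕ (combine a b) ≡ code adj R (a , b)
      toℕ-combine′ a b = trans (toℕ-combine a b) (cong (_+ toℕ b) (*-comm n (toℕ a)))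
      combined : toℕ (combine u v) ≡ toℕ (combine u′ v′)
      combined = trans (toℕ-combine′ u v) (trans eq (sym (toℕ-combine′ u′ v′)))

  4*numFaces≡length-darts : (∀ {u v} → Adj adj u v → Adj adj v u) → (R : Rotation adj) → Quadrangular adj R →
                            4 ≤ length (darts adj) → 4 * numFaces adj R ≡ length (darts adj)
  4*numFaces≡length-darts adj-sym R quadrangular 4≤N =
    Representatives.4*count-isRep≡length (faceStep adj R) (code adj R) (code-injective R) (length (darts adj)) 4≤N
      darts-unique closed (λ d∈ → quadrangular _ (∈-darts⁻ d∈))
    where
      closed : ∀ {d} → d ∈ darts adj → faceStep adj R d ∈ darts adj
      closed {u , v} d∈ = ∈-darts⁺ (Rotation.rot-adj R v u (adj-sym (∈-darts⁻ d∈)))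

  handshake : (∀ u v → adj u v ≡ adj v u) → (∀ u → adj u u ≡ false) → 2 * numEdges adj ≡ length (darts adj)
  handshake adj-sym adj-irrefl = begin
    2 * count forward pairs                       ≡⟨ cong (count forward pairs +_) (+-identityʳ _) ⟩
    count forward pairs + count forward pairs     ≡⟨ cong (count forward pairs +_) backward≡forward ⟨
    count forward pairs + count backward pairs    ≡⟨ count-split isDart lt pairs ⟨
    count isDart pairs                            ∎
    where
      open ≡-Reasoning
      pairs = cartesianProduct (allFin n) (allFin n)
      isDart lt forward backward : Fin n × Fin n → Bool
      isDart (u , v) = adj u v
      lt (u , v) = toℕ u <ᵇ toℕ v
      forward d = isDart d ∧ lt d
      backward d = isDart d ∧ not (lt d)
      flip : ∀ d → backward (swap d) ≡ forward d
      flip (u , v) with adj u v in uv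
      ... | false = cong (_∧ _) (trans (adj-sym v u) uv)
      ... | true  = cong₂ _∧_ (trans (adj-sym v u) uv) (not-<ᵇ-swap u≢v)
        where
          u≢v : toℕ u ≢ toℕ v
          u≢v eq = contradiction (trans (sym (adj-irrefl u)) (trans (cong (adj u) (toℕ-injective eq)) uv)) λ ()
          not-<ᵇ-swap : ∀ {a b} → a ≢ b → not (b <ᵇ a) ≡ (a <ᵇ b)
          not-<ᵇ-swap {a} {b} a≢b with <-cmp a b
          ... | tri< a<b _ _ rewrite ≤ᵇ-false {suc b} {a} (s≤s (<⇒≤ a<b)) | ≤ᵇ-true a<b = refl
          ... | tri≈ _ a≡b _ = contradiction a≡b a≢b
          ... | tri> _ _ b<a rewrite ≤ᵇ-true b<a | ≤ᵇ-false {suc a} {b} (s≤s (<⇒≤ b<a)) = refl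
      backward≡forward : count backward pairs ≡ count forward pairs
      backward≡forward = trans (count-swap backward (allFin⁺ n) (allFin⁺ n)) (count-cong flip pairs)

record RotationBelow (n : ℕ) (adj : ℕ → ℕ → Bool) : Set where
  field
    rot        : ℕ → ℕ → ℕ
    rot-<      : ∀ v u → rot v u < n
    rot-adj    : ∀ {v u} → v < n → u < n → T (adj v u) → T (adj v (rot v u))
    rot-inj    : ∀ {v u w} → v < n → u < n → w < n → T (adj v u) → T (adj v w) →
                 rot v u ≡ rot v w → u ≡ w
    rot-cyclic : ∀ {v u w} → v < n → u < n → w < n → T (adj v u) → T (adj v w) → Reaches (rot v) u w

  faceStepℕ : ℕ × ℕ → ℕ × ℕ
  faceStepℕ (u , v) = (v , rot v u)

module FromBelow {n : ℕ} {adj : Fin n → Fin n → Bool} {adjℕ : ℕ → ℕ → Bool}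
                 (adj≡ : ∀ u v → adj u v ≡ adjℕ (toℕ u) (toℕ v)) (Rℕ : RotationBelow n adjℕ) where
  open RotationBelow Rℕ

  private
    toAdjℕ : ∀ {u v} → Adj adj u v → T (adjℕ (toℕ u) (toℕ v))
    toAdjℕ {u} {v} = subst T (adj≡ u v)

    fromAdjℕ : ∀ {u v} → T (adjℕ (toℕ u) (toℕ v)) → Adj adj u v
    fromAdjℕ {u} {v} = subst T (sym (adj≡ u v))

  rotFin : Fin n → Fin n → Fin n
  rotFin v u = fromℕ< (rot-< (toℕ v) (toℕ u))

  toℕ-rotFin : ∀ v u → toℕ (rotFin v u) ≡ rot (toℕ v) (toℕ u)
  toℕ-rotFin v u = toℕ-fromℕ< (rot-< (toℕ v) (toℕ u))

  module IterRotFin (v : Fin n) =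
    Conjugation {g = rot (toℕ v)} toℕ (λ _ → ⊤) (λ _ → tt) (λ {u} _ → toℕ-rotFin v u)

  rotation : Rotation adj
  rotation = record
    { rot        = rotFin
    ; rot-adj    = λ v u vu → fromAdjℕ (subst (T ∘ adjℕ (toℕ v)) (sym (toℕ-rotFin v u))
                                              (rot-adj (toℕ<n v) (toℕ<n u) (toAdjℕ vu)))
    ; rot-inj    = λ v u w vu vw eq →
        toℕ-injective (rot-inj (toℕ<n v) (toℕ<n u) (toℕ<n w) (toAdjℕ vu) (toAdjℕ vw)
                               (trans (sym (toℕ-rotFin v u)) (trans (cong toℕ eq) (toℕ-rotFin v w))))
    ; rot-cyclic = λ v u w vu vw →
        let k , reach = rot-cyclic (toℕ<n v) (toℕ<n u) (toℕ<n w) (toAdjℕ vu) (toAdjℕ vw)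
        in k , toℕ-injective (trans (IterRotFin.h-iter v k tt) reach)
    }

  quadrangular : (∀ {u v} → u < n → v < n → T (adjℕ u v) → ExactPeriod faceStepℕ 4 (u , v)) →
                 Quadrangular adj rotation
  quadrangular quadℕ (u , v) uv =
    Conjugation.exactPeriod-reflect toPair (λ _ → ⊤) (λ _ → tt) (λ {d} _ → toPair-faceStep d) toPair-injective tt
      (quadℕ (toℕ<n u) (toℕ<n v) (toAdjℕ uv))
    where
      toPair : Dart adj → ℕ × ℕ
      toPair (u , v) = (toℕ u , toℕ v)
      toPair-injective : ∀ {d e} → toPair d ≡ toPair e → d ≡ e
      toPair-injective {_ , _} {_ , _} eq =
        cong₂ _,_ (toℕ-injective (cong proj₁ eq)) (toℕ-injective (cong proj₂ eq))
      toPair-faceStep : ∀ d → toPair (faceStep adj rotation d) ≡ faceStepℕ (toPair d)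
      toPair-faceStep (u , v) = cong (toℕ v ,_) (toℕ-rotFin v u)

-- The graph K_n − K_2

⌊≟⌋≡≡ᵇ : ∀ {n} (u v : Fin n) → ⌊ u ≟ v ⌋ ≡ (toℕ u ≡ᵇ toℕ v)
⌊≟⌋≡≡ᵇ u v = T-ext (λ u≡v → ≡⇒≡ᵇ _ _ (cong toℕ (toWitness u≡v)))
                   (λ u≡v → fromWitness (toℕ-injective (≡ᵇ⇒≡ _ _ u≡v)))

KminusK2ℕ : ℕ → ℕ → Bool
KminusK2ℕ a b = not (a ≡ᵇ b) ∧ not ((a <ᵇ 2) ∧ (b <ᵇ 2))

KminusK2-toℕ : ∀ n u v → KminusK2 n u v ≡ KminusK2ℕ (toℕ u) (toℕ v)
KminusK2-toℕ n u v = cong (λ b → not b ∧ not ((toℕ u <ᵇ 2) ∧ (toℕ v <ᵇ 2))) (⌊≟⌋≡≡ᵇ u v)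

KminusK2ℕ-sym : ∀ a b → KminusK2ℕ a b ≡ KminusK2ℕ b a
KminusK2ℕ-sym a b = cong₂ (λ e l → not e ∧ not l) (≡ᵇ-sym a b) (∧-comm (a <ᵇ 2) (b <ᵇ 2))
  where
    ≡ᵇ-sym : ∀ a b → (a ≡ᵇ b) ≡ (b ≡ᵇ a)
    ≡ᵇ-sym zero    zero    = refl
    ≡ᵇ-sym zero    (suc b) = refl
    ≡ᵇ-sym (suc a) zero    = refl
    ≡ᵇ-sym (suc a) (suc b) = ≡ᵇ-sym a b

KminusK2-sym : ∀ n u v → KminusK2 n u v ≡ KminusK2 n v u
KminusK2-sym n u v =
  trans (KminusK2-toℕ n u v) (trans (KminusK2ℕ-sym (toℕ u) (toℕ v)) (sym (KminusK2-toℕ n v u)))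

KminusK2-irrefl : ∀ n u → KminusK2 n u u ≡ false
KminusK2-irrefl n u with u ≟ u
... | yes _   = refl
... | no u≢u = contradiction refl u≢u

length-darts-KminusK2 : ∀ k → length (darts (KminusK2 (2 + k))) + 2 ≡ (2 + k) * (1 + k)
length-darts-KminusK2 k = begin
  length (darts G) + 2                   ≡⟨ cong (_+ 2) (count-cartesianProduct (λ (u , v) → G u v) V V) ⟩
  sum (map (λ u → count (G u) V) V) + 2  ≡⟨ cong (_+ 2) (cong₂ _+_ row-x (cong₂ _+_ row-y others)) ⟩
  k + (k + k * (1 + k)) + 2              ≡⟨ arithmetic k ⟩
  (2 + k) * (1 + k)                      ∎
  where
    open ≡-Reasoning
    G = KminusK2 (2 + k)
    V = allFin (2 + k)
    2+_ : Fin k → Fin (2 + k)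
    2+ w = Fin.suc (Fin.suc w)
    all-true : count (λ _ → true) (allFin k) ≡ k
    all-true = trans (count-all (All.universal _ (allFin k))) (length-tabulate id)
    row-x : count (G Fin.zero) V ≡ k
    row-x = trans (count-tabulate (G Fin.zero) 2+_) all-true
    row-y : count (G (Fin.suc Fin.zero)) V ≡ k
    row-y = trans (count-tabulate (G (Fin.suc Fin.zero)) 2+_) all-true
    row-other : ∀ w → count (G (2+ w)) V ≡ 1 + k
    row-other w = cong suc (begin
      suc (count (G (2+ w)) (tabulate 2+_))
        ≡⟨ cong suc (trans (count-tabulate (G (2+ w)) 2+_) (count-cong same-test (allFin k))) ⟩
      suc (count (λ w′ → not ⌊ w ≟ w′ ⌋) (allFin k))
        ≡⟨ count-≢ _≟_ (allFin⁺ k) (∈-allFin w) ⟩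
      length (allFin k)
        ≡⟨ length-tabulate id ⟩
      k ∎)
      where
        same-test : ∀ w′ → G (2+ w) (2+ w′) ≡ not ⌊ w ≟ w′ ⌋
        same-test w′ = trans (∧-identityʳ _) (cong not (trans (⌊≟⌋≡≡ᵇ (2+ w) (2+ w′)) (sym (⌊≟⌋≡≡ᵇ w w′))))
    others : sum (map (λ u → count (G u) V) (tabulate 2+_)) ≡ k * (1 + k)
    others = trans (sum-map-const (tabulate 2+_) row) (cong (_* (1 + k)) (length-tabulate 2+_))
      where
        row : ∀ {u} → u ∈ tabulate 2+_ → count (G u) V ≡ 1 + k
        row u∈ with ∈-tabulate⁻ u∈
        ... | w , refl = row-other w
    arithmetic : ∀ k → k + (k + k * (1 + k)) + 2 ≡ (2 + k) * (1 + k)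
    arithmetic = solve-∀

-- The current graph

data Current : Set where
  +odd +even -odd -even : ℕ → Current

data Direction : Set where
  toX toY : Direction
  along   : Current → Direction

reverse : Current → Current
reverse (+odd j)  = -odd j
reverse (+even j) = -even j
reverse (-odd j)  = +odd j
reverse (-even j) = +even j

index : Current → ℕ
index (+odd j)  = j
index (+even j) = j
index (-odd j)  = j
index (-even j) = j

successor : Current → Current
successor (+odd j)  = +odd (suc j)
successor (+even j) = +even (suc j)
successor c         = c

-- positive 0 is a junk value: decoding is only applied to nonzero residues.
positive : ℕ → Current
positive 0                     = +odd 0
positive 1                     = +odd 0
positive 2                     = +even 0
positive (suc (suc (suc d)))   = successor (positive (suc d))

positive-spec : ∀ d → 0 < d → (Σ ℕ λ j → positive d ≡ +odd j × d ≡ 1 + 2 * j)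
                            ⊎ (Σ ℕ λ j → positive d ≡ +even j × d ≡ 2 + 2 * j)
positive-spec 1 _ = inj₁ (0 , refl , refl)
positive-spec 2 _ = inj₂ (0 , refl , refl)
positive-spec (suc (suc (suc d))) _ with positive-spec (suc d) (s≤s z≤n)
... | inj₁ (j , eq , d≡) = inj₁ (suc j , cong successor eq , trans (cong (2 +_) d≡) (shift j))
  where shift : ∀ j → 2 + (1 + 2 * j) ≡ 1 + 2 * suc j
        shift = solve-∀
... | inj₂ (j , eq , d≡) = inj₂ (suc j , cong successor eq , trans (cong (2 +_) d≡) (shift j))
  where shift : ∀ j → 2 + (2 + 2 * j) ≡ 2 + 2 * suc j
        shift = solve-∀

magnitude : Current → ℕ
magnitude (+odd j)  = 1 + 2 * j
magnitude (+even j) = 2 + 2 * j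
magnitude (-odd j)  = 1 + 2 * j
magnitude (-even j) = 2 + 2 * j

positive-odd : ∀ j → positive (1 + 2 * j) ≡ +odd j
positive-odd zero    = refl
positive-odd (suc j) = trans (cong positive (shift j)) (cong successor (positive-odd j))
  where shift : ∀ j → 1 + 2 * suc j ≡ 3 + 2 * j
        shift = solve-∀

positive-even : ∀ j → positive (2 + 2 * j) ≡ +even j
positive-even zero    = refl
positive-even (suc j) = trans (cong positive (shift j)) (cong successor (positive-even j))
  where shift : ∀ j → 2 + 2 * suc j ≡ 4 + 2 * j
        shift = solve-∀

module Construction (t : ℕ) where

  -- With s = t + 1: m = 8s + 1, and the currents of index ≤ L = 2s − 1 are ±1, …, ±half = ±4s.
  m half L : ℕ
  m    = 9 + 8 * t
  half = 4 + 4 * t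
  L    = 1 + 2 * t

  open Modular m public

  InRange : Current → Set
  InRange c = index c ≤ L

  Valid : Direction → Set
  Valid toX       = ⊤
  Valid toY       = ⊤
  Valid (along c) = InRange c

  value : Current → ℕ
  value (+odd j)  = 1 + 2 * j
  value (+even j) = 2 + 2 * j
  value (-odd j)  = m ∸ (1 + 2 * j)
  value (-even j) = m ∸ (2 + 2 * j)

  decode : ℕ → Current
  decode d = if d ≤ᵇ half then positive d else reverse (positive (m ∸ d))

  m≡half+half+1 : m ≡ half + suc half
  m≡half+half+1 = arithmetic t
    where arithmetic : ∀ t → 9 + 8 * t ≡ (4 + 4 * t) + suc (4 + 4 * t)
          arithmetic = solve-∀

  half<m : half < m
  half<m = subst (half <_) (sym m≡half+half+1) (≤-trans (n<1+n half) (m≤n+m (suc half) half))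

  magnitude-≤ : ∀ c → InRange c → magnitude c ≤ half
  magnitude-≤ c j≤L =
    ≤-trans (even-bound c) (≤-trans (+-monoʳ-≤ 2 (*-monoʳ-≤ 2 j≤L)) (≤-reflexive (arithmetic t)))
    where
      arithmetic : ∀ t → 2 + 2 * (1 + 2 * t) ≡ 4 + 4 * t
      arithmetic = solve-∀
      even-bound : ∀ c → magnitude c ≤ 2 + 2 * index c
      even-bound (+odd j)  = n≤1+n _
      even-bound (+even j) = ≤-refl
      even-bound (-odd j)  = n≤1+n _
      even-bound (-even j) = ≤-refl

  magnitude-< : ∀ c → InRange c → magnitude c < m
  magnitude-< c c∈ = ≤-<-trans (magnitude-≤ c c∈) half<m

  inRange-odd : ∀ {j} → 1 + 2 * j ≤ half → j ≤ L
  inRange-odd {j} 1+2j≤half with j ≤? L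
  ... | yes j≤L = j≤L
  ... | no  j≰L =
    contradiction 1+2j≤half (<⇒≱ (≤-trans (≤-reflexive (arithmetic t)) (s≤s (*-monoʳ-≤ 2 (≰⇒> j≰L)))))
    where
      arithmetic : ∀ t → suc (4 + 4 * t) ≡ suc (2 * suc (1 + 2 * t))
      arithmetic = solve-∀

  value-range : ∀ c → InRange c → 0 < value c × value c < m
  value-range c@(+odd j)  c∈ = s≤s z≤n , magnitude-< c c∈
  value-range c@(+even j) c∈ = s≤s z≤n , magnitude-< c c∈
  value-range c@(-odd j)  c∈ = m<n⇒0<n∸m (magnitude-< c c∈) , ∸-monoʳ-< (s≤s z≤n) (<⇒≤ (magnitude-< c c∈))
  value-range c@(-even j) c∈ = m<n⇒0<n∸m (magnitude-< c c∈) , ∸-monoʳ-< (s≤s z≤n) (<⇒≤ (magnitude-< c c∈))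

  value-reverse : ∀ c → InRange c → value (reverse c) ≡ m ∸ value c
  value-reverse (+odd j)  _  = refl
  value-reverse (+even j) _  = refl
  value-reverse (-odd j)  c∈ = sym (m∸[m∸n]≡n (<⇒≤ (magnitude-< (-odd j) c∈)))
  value-reverse (-even j) c∈ = sym (m∸[m∸n]≡n (<⇒≤ (magnitude-< (-even j) c∈)))

  private
    half<m∸ : ∀ {d} → d ≤ half → half < m ∸ d
    half<m∸ {d} d≤half =
      ≤-trans (≤-reflexive (sym (trans (cong (_∸ half) m≡half+half+1) (m+n∸m≡n half (suc half)))))
              (∸-monoʳ-≤ m d≤half)

    m∸≤half : ∀ {d} → half < d → m ∸ d ≤ half
    m∸≤half {d} half<d = ≤-trans (∸-monoʳ-≤ m half<d)
                                 (≤-reflexive (trans (cong (_∸ suc half) m≡half+half+1) (m+n∸n≡m half (suc half))))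

  decode-value : ∀ c → InRange c → decode (value c) ≡ c
  decode-value (+odd j) c∈ rewrite ≤ᵇ-true (magnitude-≤ (+odd j) c∈) = positive-odd j
  decode-value (+even j) c∈ rewrite ≤ᵇ-true (magnitude-≤ (+even j) c∈) = positive-even j
  decode-value (-odd j) c∈ rewrite ≤ᵇ-false (half<m∸ (magnitude-≤ (-odd j) c∈))
                                 | m∸[m∸n]≡n (<⇒≤ (magnitude-< (-odd j) c∈)) | positive-odd j = refl
  decode-value (-even j) c∈ rewrite ≤ᵇ-false (half<m∸ (magnitude-≤ (-even j) c∈))
                                  | m∸[m∸n]≡n (<⇒≤ (magnitude-< (-even j) c∈)) | positive-even j = refl

  value-decode : ∀ {d} → 0 < d → d < m → value (decode d) ≡ d × InRange (decode d)
  value-decode {d} 0<d d<m with d ≤? half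
  ... | yes d≤half rewrite ≤ᵇ-true d≤half with positive-spec d 0<d
  ...   | inj₁ (j , eq , refl) rewrite eq = refl , inRange-odd d≤half
  ...   | inj₂ (j , eq , refl) rewrite eq = refl , inRange-odd (≤-trans (n≤1+n _) d≤half)
  value-decode {d} 0<d d<m | no d≰half rewrite ≤ᵇ-false (≰⇒> d≰half)
    with positive-spec (m ∸ d) (m<n⇒0<n∸m d<m)
  ... | inj₁ (j , eq , m∸d≡) rewrite eq =
          trans (cong (m ∸_) (sym m∸d≡)) (m∸[m∸n]≡n (<⇒≤ d<m)) ,
          inRange-odd (subst (_≤ half) m∸d≡ (m∸≤half (≰⇒> d≰half)))
  ... | inj₂ (j , eq , m∸d≡) rewrite eq =
          trans (cong (m ∸_) (sym m∸d≡)) (m∸[m∸n]≡n (<⇒≤ d<m)) ,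
          inRange-odd (≤-trans (n≤1+n _) (subst (_≤ half) m∸d≡ (m∸≤half (≰⇒> d≰half))))

  -- Writing s = t + 1, the cyclic order of ρ is toX, −2, +3, −6, +7, …, −(4s−2), +(4s−1), toY,
  -- +4s, +(4s−2), …, +2, +1, −4, +5, −8, …, +(4s−3), −4s, −(4s−1), −(4s−3), …, −1.
  ρ : Direction → Direction
  ρ toX                     = along (-even 0)
  ρ toY                     = along (+even L)
  ρ (along (+odd j))        = if j ≡ᵇ L then toY else along (-even (suc j))
  ρ (along (+even zero))    = along (+odd 0)
  ρ (along (+even (suc j))) = along (+even j)
  ρ (along (-odd zero))     = toX
  ρ (along (-odd (suc j)))  = along (-odd j)
  ρ (along (-even j))       = if j ≡ᵇ L then along (-odd L) else along (+odd (suc j))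

  ρ⁻¹ : Direction → Direction
  ρ⁻¹ toX                     = along (-odd 0)
  ρ⁻¹ toY                     = along (+odd L)
  ρ⁻¹ (along (+odd zero))     = along (+even 0)
  ρ⁻¹ (along (+odd (suc j)))  = along (-even j)
  ρ⁻¹ (along (+even j))       = if j ≡ᵇ L then toY else along (+even (suc j))
  ρ⁻¹ (along (-odd j))        = if j ≡ᵇ L then along (-even L) else along (-odd (suc j))
  ρ⁻¹ (along (-even zero))    = toX
  ρ⁻¹ (along (-even (suc j))) = along (+odd j)

  ≡ᵇL-< : ∀ {j} → j < L → (j ≡ᵇ L) ≡ false
  ≡ᵇL-< j<L = ≡ᵇ-false (<⇒≢ j<L)

  ρ+oddL : ρ (along (+odd L)) ≡ toY
  ρ+oddL rewrite ≡ᵇ-refl L = refl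

  ρ-evenL : ρ (along (-even L)) ≡ along (-odd L)
  ρ-evenL rewrite ≡ᵇ-refl L = refl

  ρ⁻¹+evenL : ρ⁻¹ (along (+even L)) ≡ toY
  ρ⁻¹+evenL rewrite ≡ᵇ-refl L = refl

  ρ⁻¹-oddL : ρ⁻¹ (along (-odd L)) ≡ along (-even L)
  ρ⁻¹-oddL rewrite ≡ᵇ-refl L = refl

  ρ-valid : ∀ e → Valid e → Valid (ρ e)
  ρ-valid toX                     _   = z≤n
  ρ-valid toY                     _   = ≤-refl
  ρ-valid (along (+odd j))        j≤L with m≤n⇒m<n∨m≡n j≤L
  ... | inj₁ j<L rewrite ≡ᵇL-< j<L = j<L
  ... | inj₂ refl rewrite ρ+oddL = tt
  ρ-valid (along (+even zero))    _   = z≤n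
  ρ-valid (along (+even (suc j))) j≤L = <⇒≤ j≤L
  ρ-valid (along (-odd zero))     _   = tt
  ρ-valid (along (-odd (suc j)))  j≤L = <⇒≤ j≤L
  ρ-valid (along (-even j))       j≤L with m≤n⇒m<n∨m≡n j≤L
  ... | inj₁ j<L rewrite ≡ᵇL-< j<L = j<L
  ... | inj₂ refl rewrite ρ-evenL = ≤-refl

  ρ⁻¹-ρ : ∀ e → Valid e → ρ⁻¹ (ρ e) ≡ e
  ρ⁻¹-ρ toX                     _   = refl
  ρ⁻¹-ρ toY                     _   = ρ⁻¹+evenL
  ρ⁻¹-ρ (along (+odd j))        j≤L with m≤n⇒m<n∨m≡n j≤L
  ... | inj₁ j<L rewrite ≡ᵇL-< j<L = refl
  ... | inj₂ refl = cong ρ⁻¹ ρ+oddL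
  ρ⁻¹-ρ (along (+even zero))    _   = refl
  ρ⁻¹-ρ (along (+even (suc j))) j<L rewrite ≡ᵇL-< j<L = refl
  ρ⁻¹-ρ (along (-odd zero))     _   = refl
  ρ⁻¹-ρ (along (-odd (suc j)))  j<L rewrite ≡ᵇL-< j<L = refl
  ρ⁻¹-ρ (along (-even j))       j≤L with m≤n⇒m<n∨m≡n j≤L
  ... | inj₁ j<L rewrite ≡ᵇL-< j<L = refl
  ... | inj₂ refl = trans (cong ρ⁻¹ ρ-evenL) ρ⁻¹-oddL

  ρ-injective : ∀ {e e′} → Valid e → Valid e′ → ρ e ≡ ρ e′ → e ≡ e′
  ρ-injective {e} {e′} e✓ e′✓ eq = trans (sym (ρ⁻¹-ρ e e✓)) (trans (cong ρ⁻¹ eq) (ρ⁻¹-ρ e′ e′✓))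

  zigzag : Bool → ℕ → Direction
  zigzag true  j = along (+odd j)
  zigzag false j = along (-even j)

  ρ-zigzag : ∀ b j → j < L → ρ (zigzag b j) ≡ zigzag (not b) (suc j)
  ρ-zigzag true  j j<L rewrite ≡ᵇL-< j<L = refl
  ρ-zigzag false j j<L rewrite ≡ᵇL-< j<L = refl

  reaches-zigzag : ∀ b {j} → j ≤ L → Reaches ρ (zigzag (iter not j b) 0) (zigzag b j)
  reaches-zigzag b {j} j≤L =
    subst (λ b′ → Reaches ρ (zigzag (iter not j b) 0) (zigzag b′ j)) (iter-not-twice j b)
          (reaches-alternating ρ zigzag ρ-zigzag (iter not j b) j≤L)

  iter-not-L : ∀ b → iter not L b ≡ not b
  iter-not-L b = cong not (trans (cong (λ k → iter not k b) (*-comm 2 t)) (iter-*-fixed not (not-involutive b) t))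

  toX⇝-even0 : Reaches ρ toX (along (-even 0))
  toX⇝-even0 = 1 , refl

  toX⇝+oddL : Reaches ρ toX (along (+odd L))
  toX⇝+oddL = reaches-trans ρ toX⇝-even0
    (subst (λ b → Reaches ρ (zigzag b 0) (along (+odd L))) (iter-not-L true) (reaches-zigzag true ≤-refl))

  toX⇝toY : Reaches ρ toX toY
  toX⇝toY = reaches-step ρ toX⇝+oddL ρ+oddL

  toX⇝+even : ∀ {j} → j ≤ L → Reaches ρ toX (along (+even j))
  toX⇝+even j≤L =
    reaches-trans ρ (reaches-step ρ toX⇝toY refl) (reaches-descending ρ (along ∘ +even) (λ _ → refl) j≤L)

  toX⇝zigzag0 : ∀ b → Reaches ρ toX (zigzag b 0)
  toX⇝zigzag0 true  = reaches-step ρ (toX⇝+even z≤n) refl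
  toX⇝zigzag0 false = toX⇝-even0

  toX⇝zigzag : ∀ b {j} → j ≤ L → Reaches ρ toX (zigzag b j)
  toX⇝zigzag b {j} j≤L = reaches-trans ρ (toX⇝zigzag0 (iter not j b)) (reaches-zigzag b j≤L)

  toX⇝-odd : ∀ {j} → j ≤ L → Reaches ρ toX (along (-odd j))
  toX⇝-odd j≤L = reaches-trans ρ
    (reaches-step ρ (toX⇝zigzag false ≤-refl) ρ-evenL)
    (reaches-descending ρ (along ∘ -odd) (λ _ → refl) j≤L)

  toX⇝ : ∀ e → Valid e → Reaches ρ toX e
  toX⇝ toX              _   = reaches-refl ρ
  toX⇝ toY              _   = toX⇝toY
  toX⇝ (along (+odd j))  j≤L = toX⇝zigzag true j≤L
  toX⇝ (along (+even j)) j≤L = toX⇝+even j≤L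
  toX⇝ (along (-odd j))  j≤L = toX⇝-odd j≤L
  toX⇝ (along (-even j)) j≤L = toX⇝zigzag false j≤L

  ρ-cycle : Σ ℕ λ q → iter ρ (suc q) toX ≡ toX
  ρ-cycle = let q , reach = toX⇝-odd z≤n in q , cong ρ reach

  ρ-cyclic : ∀ {e e′} → Valid e → Valid e′ → Reaches ρ e e′
  ρ-cyclic {e} {e′} e✓ e′✓ =
    reaches-trans ρ (reaches-back ρ {proj₁ ρ-cycle} (proj₂ ρ-cycle) (toX⇝ e e✓)) (toX⇝ e′ e′✓)

  n : ℕ
  n = 2 + m

  neighbour : ℕ → Direction → ℕ
  neighbour i toX       = 0
  neighbour i toY       = 1
  neighbour i (along c) = 2 + (i ⊕ value c)

  direction : ℕ → ℕ → Direction
  direction i 0             = toX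
  direction i 1             = toY
  direction i (suc (suc j)) = along (decode (j ⊖ i))

  rotℕ : ℕ → ℕ → ℕ
  rotℕ 0             u = 2 + ((u ∸ 2) ⊕ 1)
  rotℕ 1             u = 2 + ((u ∸ 2) ⊕ (m ∸ 1))
  rotℕ (suc (suc i)) u = neighbour i (ρ (direction i u))

  neighbour-< : ∀ i e → neighbour i e < n
  neighbour-< i toX       = s≤s z≤n
  neighbour-< i toY       = s≤s (s≤s z≤n)
  neighbour-< i (along c) = s≤s (s≤s (⊕-< i (value c)))

  direction-neighbour : ∀ {i} e → i < m → Valid e → direction i (neighbour i e) ≡ e
  direction-neighbour toX       _   _  = refl
  direction-neighbour toY       _   _  = refl
  direction-neighbour (along c) i<m c∈ =
    cong along (trans (cong decode (⊖-⊕ i<m (proj₂ (value-range c c∈)))) (decode-value c c∈))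

  adjacent⇒≢ : ∀ {u v} → T (KminusK2ℕ u v) → u ≢ v
  adjacent⇒≢ {u} uu refl rewrite ≡ᵇ-refl u = uu

  ≢⇒adjacent : ∀ {i v} → 2 + i ≢ v → T (KminusK2ℕ (2 + i) v)
  ≢⇒adjacent {i} {v} i≢v rewrite ≡ᵇ-false i≢v = tt

  neighbour-direction : ∀ {i u} → i < m → u < n → T (KminusK2ℕ (2 + i) u) →
                        neighbour i (direction i u) ≡ u × Valid (direction i u)
  neighbour-direction {u = 0}           _   _                 _   = refl , tt
  neighbour-direction {u = 1}           _   _                 _   = refl , tt
  neighbour-direction {i} {suc (suc j)} i<m (s≤s (s≤s j<m)) adj =
    cong (2 +_) (trans (cong (i ⊕_) (proj₁ decoded)) (⊕-⊖ i<m j<m)) , proj₂ decoded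
    where
      decoded : value (decode (j ⊖ i)) ≡ j ⊖ i × InRange (decode (j ⊖ i))
      decoded = value-decode (⊖-nonzero i<m j<m (adjacent⇒≢ adj ∘ cong (2 +_) ∘ sym)) (⊕-< j (m ∸ i))

  neighbour-≢ : ∀ {i} e → i < m → Valid e → neighbour i e ≢ 2 + i
  neighbour-≢ toX       _   _  ()
  neighbour-≢ toY       _   _  ()
  neighbour-≢ (along c) i<m c∈ eq =
    ⊕-≢ i<m (proj₁ (value-range c c∈)) (proj₂ (value-range c c∈)) (suc-injective (suc-injective eq))

  adjacent-neighbour : ∀ {i} e → i < m → Valid e → T (KminusK2ℕ (2 + i) (neighbour i e))
  adjacent-neighbour e i<m e✓ = ≢⇒adjacent (neighbour-≢ e i<m e✓ ∘ sym)

  2+⊕-cancelʳ : ∀ {j k v} → j < m → k < m → v ≤ m → 2 + (j ⊕ v) ≡ 2 + (k ⊕ v) → 2 + j ≡ 2 + k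
  2+⊕-cancelʳ j<m k<m v≤m eq = cong (2 +_) (⊕-cancelʳ j<m k<m v≤m (suc-injective (suc-injective eq)))

  rotℕ-< : ∀ v u → rotℕ v u < n
  rotℕ-< 0             u = s≤s (s≤s (⊕-< (u ∸ 2) 1))
  rotℕ-< 1             u = s≤s (s≤s (⊕-< (u ∸ 2) (m ∸ 1)))
  rotℕ-< (suc (suc i)) u = neighbour-< i (ρ (direction i u))

  rotℕ-adjacent : ∀ {v u} → v < n → u < n → T (KminusK2ℕ v u) → T (KminusK2ℕ v (rotℕ v u))
  rotℕ-adjacent {0}           {suc (suc _)} _ _ _ = tt
  rotℕ-adjacent {1}           {suc (suc _)} _ _ _ = tt
  rotℕ-adjacent {suc (suc i)} {u} (s≤s (s≤s i<m)) u<n adj =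
    adjacent-neighbour (ρ (direction i u)) i<m (ρ-valid _ (proj₂ (neighbour-direction i<m u<n adj)))

  rotℕ-injective : ∀ {v u w} → v < n → u < n → w < n → T (KminusK2ℕ v u) → T (KminusK2ℕ v w) →
                   rotℕ v u ≡ rotℕ v w → u ≡ w
  rotℕ-injective {0} {suc (suc _)} {suc (suc _)} _ (s≤s (s≤s j<m)) (s≤s (s≤s k<m)) _ _ =
    2+⊕-cancelʳ j<m k<m (s≤s z≤n)
  rotℕ-injective {1} {suc (suc _)} {suc (suc _)} _ (s≤s (s≤s j<m)) (s≤s (s≤s k<m)) _ _ =
    2+⊕-cancelʳ j<m k<m (m∸n≤m m 1)
  rotℕ-injective {suc (suc i)} {u} {w} (s≤s (s≤s i<m)) u<n w<n adj-u adj-w eq = begin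
    u                            ≡⟨ proj₁ (neighbour-direction i<m u<n adj-u) ⟨
    neighbour i (direction i u)  ≡⟨ cong (neighbour i) same-direction ⟩
    neighbour i (direction i w)  ≡⟨ proj₁ (neighbour-direction i<m w<n adj-w) ⟩
    w                            ∎
    where
      open ≡-Reasoning
      u✓ = proj₂ (neighbour-direction i<m u<n adj-u)
      w✓ = proj₂ (neighbour-direction i<m w<n adj-w)
      same-direction : direction i u ≡ direction i w
      same-direction = ρ-injective u✓ w✓ (trans (sym (direction-neighbour _ i<m (ρ-valid _ u✓)))
                         (trans (cong (direction i) eq) (direction-neighbour _ i<m (ρ-valid _ w✓))))

  rotℕ-cyclic : ∀ {v u w} → v < n → u < n → w < n → T (KminusK2ℕ v u) → T (KminusK2ℕ v w) →
                Reaches (rotℕ v) u w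
  rotℕ-cyclic {0} {suc (suc _)} {suc (suc _)} _ (s≤s (s≤s j<m)) (s≤s (s≤s k<m)) _ _ =
    Conjugation.reaches-map {f = _⊕ 1} {g = rotℕ 0} (2 +_) (λ _ → ⊤) (λ _ → tt) (λ _ → refl) tt
      (reaches-⊕1 j<m k<m)
  rotℕ-cyclic {1} {suc (suc _)} {suc (suc _)} _ (s≤s (s≤s j<m)) (s≤s (s≤s k<m)) _ _ =
    Conjugation.reaches-map {f = _⊕ (m ∸ 1)} {g = rotℕ 1} (2 +_) (λ _ → ⊤) (λ _ → tt) (λ _ → refl) tt
      (reaches-inverse (_< m) (λ {x} _ → ⊕-< x 1) (λ x<m → ⊕-undo x<m (s≤s z≤n)) k<m (reaches-⊕1 k<m j<m))
  rotℕ-cyclic {suc (suc i)} {u} {w} (s≤s (s≤s i<m)) u<n w<n adj-u adj-w =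
    subst₂ (Reaches (rotℕ (2 + i))) (proj₁ local-u) (proj₁ local-w)
      (Conjugation.reaches-map {f = ρ} {g = rotℕ (2 + i)} (neighbour i) Valid (ρ-valid _)
         (λ {e} e✓ → cong (neighbour i ∘ ρ) (sym (direction-neighbour e i<m e✓)))
         (proj₂ local-u) (ρ-cyclic (proj₂ local-u) (proj₂ local-w)))
    where
      local-u = neighbour-direction i<m u<n adj-u
      local-w = neighbour-direction i<m w<n adj-w

  rotationBelow : RotationBelow n KminusK2ℕ
  rotationBelow = record
    { rot        = rotℕ
    ; rot-<      = rotℕ-<
    ; rot-adj    = rotℕ-adjacent
    ; rot-inj    = rotℕ-injective
    ; rot-cyclic = rotℕ-cyclic
    }

  trace : ℕ × ℕ → ℕ × ℕ
  trace = RotationBelow.faceStepℕ rotationBelow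

  dart : ℕ → Direction → ℕ × ℕ
  dart i e = (2 + i , neighbour i e)

  φ : Current → Direction
  φ c = ρ (along (reverse c))

  inRange-reverse : ∀ c → InRange c → InRange (reverse c)
  inRange-reverse (+odd j)  c∈ = c∈
  inRange-reverse (+even j) c∈ = c∈
  inRange-reverse (-odd j)  c∈ = c∈
  inRange-reverse (-even j) c∈ = c∈

  trace-along : ∀ {i} c → i < m → InRange c → trace (dart i (along c)) ≡ dart (i ⊕ value c) (φ c)
  trace-along {i} c i<m c∈ = cong (λ d → dart (i ⊕ value c) (ρ (along d))) reversed
    where
      range = value-range c c∈
      reversed : decode (i ⊖ (i ⊕ value c)) ≡ reverse c
      reversed = begin
        decode (i ⊖ (i ⊕ value c))  ≡⟨ cong decode (⊖-⊕-reverse i<m (proj₁ range) (<⇒≤ (proj₂ range))) ⟩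
        decode (m ∸ value c)        ≡⟨ cong decode (value-reverse c c∈) ⟨
        decode (value (reverse c))  ≡⟨ decode-value (reverse c) (inRange-reverse c c∈) ⟩
        reverse c                   ∎
        where open ≡-Reasoning

  dart-injective : ∀ {i i′ e e′} → i < m → Valid e → Valid e′ → dart i e ≡ dart i′ e′ → e ≡ e′
  dart-injective {i} {e = e} {e′} i<m e✓ e′✓ eq with suc-injective (suc-injective (cong proj₁ eq))
  ... | refl = begin
    e                            ≡⟨ direction-neighbour e i<m e✓ ⟨
    direction i (neighbour i e)  ≡⟨ cong (direction i ∘ proj₂) eq ⟩
    direction i (neighbour i e′) ≡⟨ direction-neighbour e′ i<m e′✓ ⟩
    e′                           ∎
    where open ≡-Reasoning

  along-≢ : ∀ {i i′ c c′} → i < m → InRange c → InRange c′ → c ≢ c′ →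
            dart i (along c) ≢ dart i′ (along c′)
  along-≢ {c = c} {c′} i<m c∈ c′∈ c≢c′ eq with dart-injective {e = along c} {along c′} i<m c∈ c′∈ eq
  ... | refl = c≢c′ refl


  -- A φ-cycle of four currents with total 0 in ℤ_m lifts to a 4-gonal face through every vertex 2 + i.
  lifted-face : ∀ {c₀ c₁ c₂ c₃} → InRange c₀ → InRange c₁ → InRange c₂ → InRange c₃ →
                φ c₀ ≡ along c₁ → φ c₁ ≡ along c₂ → φ c₂ ≡ along c₃ → φ c₃ ≡ along c₀ →
                m ∣ value c₀ + value c₁ + value c₂ + value c₃ → c₁ ≢ c₀ → c₂ ≢ c₀ → c₃ ≢ c₀ →
                ∀ {i} → i < m → ExactPeriod trace 4 (dart i (along c₀))
  lifted-face {c₀} {c₁} {c₂} {c₃} r₀ r₁ r₂ r₃ φ₀ φ₁ φ₂ φ₃ m∣ c₁≢c₀ c₂≢c₀ c₃≢c₀ {i} i<m =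
    cycle4⇒exactPeriod4 trace
      (trans (trace-along c₀ i<m r₀) (cong (dart i₁) φ₀))
      (trans (trace-along c₁ i₁<m r₁) (cong (dart i₂) φ₁))
      (trans (trace-along c₂ i₂<m r₂) (cong (dart i₃) φ₂))
      (trans (trace-along c₃ i₃<m r₃) (cong₂ dart closes φ₃))
      (along-≢ i₁<m r₁ r₀ c₁≢c₀) (along-≢ i₂<m r₂ r₀ c₂≢c₀) (along-≢ i₃<m r₃ r₀ c₃≢c₀)
    where
      i₁ = i ⊕ value c₀
      i₂ = i₁ ⊕ value c₁
      i₃ = i₂ ⊕ value c₂
      i₁<m = ⊕-< i (value c₀)
      i₂<m = ⊕-< i₁ (value c₁)
      i₃<m = ⊕-< i₂ (value c₂)
      closes : i₃ ⊕ value c₃ ≡ i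
      closes = trans (cong (λ k → (k ⊕ value c₂) ⊕ value c₃) (⊕-assoc i (value c₀) (value c₁)))
                     (⊕-closes i<m m∣)

  generic-faces : ∀ {i j} → i < m → suc j ≤ L →
                  ExactPeriod trace 4 (dart i (along (+odd (suc j)))) × ExactPeriod trace 4 (dart i (along (-odd j)))
                × ExactPeriod trace 4 (dart i (along (-even (suc j)))) × ExactPeriod trace 4 (dart i (along (+even j)))
  generic-faces {i} {j} i<m j<L =
      lifted-face r₀ r₁ r₀ r₁ refl φ₁ refl φ₃ m∣₀ (λ ()) (λ ()) (λ ()) i<m
    , lifted-face r₁ r₀ r₁ r₀ φ₁ refl φ₃ refl m∣₁ (λ ()) (λ ()) (λ ()) i<m
    , lifted-face r₀ r₁ r₀ r₁ refl φ₃ refl φ₁ m∣₂ (λ ()) (λ ()) (λ ()) i<m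
    , lifted-face r₁ r₀ r₁ r₀ φ₃ refl φ₁ refl m∣₃ (λ ()) (λ ()) (λ ()) i<m
    where
      v₀ = value (+odd (suc j))
      v₁ = value (-odd j)
      v₂ = value (-even (suc j))
      v₃ = value (+even j)
      r₀ : suc j ≤ L
      r₀ = j<L
      r₁ : j ≤ L
      r₁ = <⇒≤ j<L
      φ₁ : φ (-odd j) ≡ along (-even (suc j))
      φ₁ rewrite ≡ᵇL-< j<L = refl
      φ₃ : φ (+even j) ≡ along (+odd (suc j))
      φ₃ rewrite ≡ᵇL-< j<L = refl
      m∣₀ : m ∣ v₀ + v₁ + v₂ + v₃
      m∣₀ = divides 2 (begin
        1 + 2 * suc j + A + B + (2 + 2 * j)           ≡⟨ arithmetic j A B ⟩
        (A + (1 + 2 * j)) + (B + (2 + 2 * suc j))     ≡⟨ cong₂ _+_ (m∸n+n≡m (<⇒≤ (magnitude-< (-odd j) r₁)))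
                                                                  (m∸n+n≡m (<⇒≤ (magnitude-< (-even (suc j)) r₀))) ⟩
        m + m                                         ≡⟨ cong (m +_) (+-identityʳ m) ⟨
        2 * m                                         ∎)
        where
          open ≡-Reasoning
          A = m ∸ (1 + 2 * j)
          B = m ∸ (2 + 2 * suc j)
          arithmetic : ∀ j A B → 1 + 2 * suc j + A + B + (2 + 2 * j) ≡ (A + (1 + 2 * j)) + (B + (2 + 2 * suc j))
          arithmetic = solve-∀
      m∣₁ = ∣-rotate4 v₀ v₁ v₂ v₃ m∣₀
      m∣₂ = ∣-rotate4 v₁ v₂ v₃ v₀ m∣₁
      m∣₃ = ∣-rotate4 v₂ v₃ v₀ v₁ m∣₂

  apex-faces : ∀ Z A B (z c : ℕ) → z < 2 → (∀ k → neighbour k Z ≡ z) →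
               (∀ k → trace (2 + k , z) ≡ (z , 2 + (k ⊕ c))) → (∀ k → trace (z , 2 + k) ≡ dart k (ρ Z)) →
               ρ Z ≡ along A → φ A ≡ along B → φ B ≡ Z → InRange A → InRange B → A ≢ B →
               m ∣ value A + value B + c →
               ∀ {i} → i < m → ExactPeriod trace 4 (z , 2 + i) × ExactPeriod trace 4 (dart i (along A))
                             × ExactPeriod trace 4 (dart i (along B)) × ExactPeriod trace 4 (2 + i , z)
  apex-faces Z A B z c z<2 neighbour-Z into out ρZ φA φB rA rB A≢B m∣ {i} i<m =
    from-apex , from-A , from-B , into-apex
    where
      a = value A
      b = value B
      stepA : ∀ {k} → k < m → trace (dart k (along A)) ≡ dart (k ⊕ a) (along B)
      stepA k<m = trans (trace-along A k<m rA) (cong (dart _) φA)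
      stepB : ∀ {k} → k < m → trace (dart k (along B)) ≡ (2 + (k ⊕ b) , z)
      stepB {k} k<m = trans (trace-along B k<m rB)
                            (cong (2 + (k ⊕ b) ,_) (trans (cong (neighbour (k ⊕ b)) φB) (neighbour-Z _)))
      stepZ : ∀ k → trace (z , 2 + k) ≡ dart k (along A)
      stepZ k = trans (out k) (cong (dart k) ρZ)
      apex≢ : ∀ {k} → z ≢ 2 + k
      apex≢ eq = <⇒≱ z<2 (subst (2 ≤_) (sym eq) (s≤s (s≤s z≤n)))
      first≢ : ∀ {x y k} → (z , x) ≢ (2 + k , y)
      first≢ = apex≢ ∘ cong proj₁
      second≢ : ∀ {x y k} → (x , z) ≢ (y , 2 + k)
      second≢ = apex≢ ∘ cong proj₂
      from-apex : ExactPeriod trace 4 (z , 2 + i)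
      from-apex = cycle4⇒exactPeriod4 trace (stepZ i) (stepA i<m) (stepB (⊕-< i a))
                    (trans (into _) (cong (λ k → (z , 2 + k)) (⊕-closes i<m m∣)))
                    (first≢ ∘ sym) (first≢ ∘ sym) (first≢ ∘ sym)
      from-A : ExactPeriod trace 4 (dart i (along A))
      from-A = cycle4⇒exactPeriod4 trace (stepA i<m) (stepB (⊕-< i a)) (into _)
                 (trans (stepZ _) (cong (λ k → dart k (along A)) (⊕-closes i<m m∣)))
                 (along-≢ (⊕-< i a) rB rA (A≢B ∘ sym)) second≢ first≢
      from-B : ExactPeriod trace 4 (dart i (along B))
      from-B = cycle4⇒exactPeriod4 trace (stepB i<m) (into _) (stepZ _)
                 (trans (stepA (⊕-< (i ⊕ b) c))
                        (cong (λ k → dart k (along B)) (⊕-closes i<m (∣-rotate a b c m∣))))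
                 second≢ first≢ (along-≢ (⊕-< (i ⊕ b) c) rA rB A≢B)
      into-apex : ExactPeriod trace 4 (2 + i , z)
      into-apex = cycle4⇒exactPeriod4 trace (into i) (stepZ _) (stepA (⊕-< i c))
                    (trans (stepB (⊕-< (i ⊕ c) a))
                           (cong (λ k → (2 + k , z)) (⊕-closes i<m (∣-rotate b c a (∣-rotate a b c m∣)))))
                    first≢ (second≢ ∘ sym) (second≢ ∘ sym)

  x-faces : ∀ {i} → i < m →
            ExactPeriod trace 4 (0 , 2 + i) × ExactPeriod trace 4 (dart i (along (-even 0)))
          × ExactPeriod trace 4 (dart i (along (+odd 0))) × ExactPeriod trace 4 (2 + i , 0)
  x-faces = apex-faces toX (-even 0) (+odd 0) 0 1 (s≤s z≤n) (λ _ → refl) (λ _ → refl) (λ _ → refl)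
                      refl refl refl z≤n z≤n (λ ()) (divides 1 (arithmetic t))
    where arithmetic : ∀ t → 7 + 8 * t + 1 + 1 ≡ 1 * (9 + 8 * t)
          arithmetic = solve-∀

  y-faces : ∀ {i} → i < m →
            ExactPeriod trace 4 (1 , 2 + i) × ExactPeriod trace 4 (dart i (along (+even L)))
          × ExactPeriod trace 4 (dart i (along (-odd L))) × ExactPeriod trace 4 (2 + i , 1)
  y-faces = apex-faces toY (+even L) (-odd L) 1 (m ∸ 1) (s≤s (s≤s z≤n)) (λ _ → refl) (λ _ → refl) (λ _ → refl)
                      refl ρ-evenL ρ+oddL ≤-refl ≤-refl (λ ())
                      (divides 2 (trans (arithmetic t X) (trans (cong (_+ m) X+1+2L≡m) (cong (m +_) (sym (+-identityʳ m))))))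
    where X = m ∸ (1 + 2 * L)
          X+1+2L≡m = m∸n+n≡m (<⇒≤ (magnitude-< (-odd L) ≤-refl))
          arithmetic : ∀ t X → 2 + 2 * (1 + 2 * t) + X + (8 + 8 * t) ≡ X + (1 + 2 * (1 + 2 * t)) + (9 + 8 * t)
          arithmetic = solve-∀

  dart-quadrangular : ∀ {i} e → i < m → Valid e → ExactPeriod trace 4 (dart i e)
  dart-quadrangular toX i<m _ = let _ , _ , _ , q = x-faces i<m in q
  dart-quadrangular toY i<m _ = let _ , _ , _ , q = y-faces i<m in q
  dart-quadrangular (along (+odd zero))     i<m _   = let _ , _ , q , _ = x-faces i<m in q
  dart-quadrangular (along (+odd (suc j)))  i<m j<L = let q , _ , _ , _ = generic-faces i<m j<L in q
  dart-quadrangular (along (-even zero))    i<m _   = let _ , q , _ , _ = x-faces i<m in q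
  dart-quadrangular (along (-even (suc j))) i<m j<L = let _ , _ , q , _ = generic-faces i<m j<L in q
  dart-quadrangular (along (-odd j)) i<m j≤L with m≤n⇒m<n∨m≡n j≤L
  ... | inj₁ j<L = let _ , q , _ , _ = generic-faces i<m j<L in q
  ... | inj₂ refl = let _ , _ , q , _ = y-faces i<m in q
  dart-quadrangular (along (+even j)) i<m j≤L with m≤n⇒m<n∨m≡n j≤L
  ... | inj₁ j<L = let _ , _ , _ , q = generic-faces i<m j<L in q
  ... | inj₂ refl = let _ , q , _ , _ = y-faces i<m in q

  quadrangularℕ : ∀ {u v} → u < n → v < n → T (KminusK2ℕ u v) → ExactPeriod trace 4 (u , v)
  quadrangularℕ {0} {suc (suc j)} _ (s≤s (s≤s j<m)) _ = let q , _ = x-faces j<m in q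
  quadrangularℕ {1} {suc (suc j)} _ (s≤s (s≤s j<m)) _ = let q , _ = y-faces j<m in q
  quadrangularℕ {suc (suc i)} {v} (s≤s (s≤s i<m)) v<n adj =
    subst (λ w → ExactPeriod trace 4 (2 + i , w)) (proj₁ local) (dart-quadrangular (direction i v) i<m (proj₂ local))
    where local = neighbour-direction i<m v<n adj

-- Euler's formula

QuadrangularEmbedding : ℕ → ℕ → Set
QuadrangularEmbedding n h =
  Σ (Rotation (KminusK2 n)) λ R → Quadrangular (KminusK2 n) R × InSurfaceOfGenus (KminusK2 n) R h

-- F = D/4 faces and E = D/2 edges for D darts, on n = 11 + 8t = 8s + 3 vertices (s = t + 1).
genus-count : ∀ t {F E D} → 4 * F ≡ D → 2 * E ≡ D → D + 2 ≡ (11 + 8 * t) * (10 + 8 * t) →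
              11 + 8 * t + F + 2 * (8 * suc t * suc t + suc t) ≡ 2 + E
genus-count t {F} {E} {D} 4F≡D 2E≡D D+2≡ = *-cancelˡ-≡ _ _ 4 (begin
  4 * (n + F + 2 * h)    ≡⟨ distribute n F h ⟩
  4 * n + 8 * h + 4 * F  ≡⟨ cong (4 * n + 8 * h +_) 4F≡D ⟩
  4 * n + 8 * h + D      ≡⟨ cong (_+ D) (+-cancelʳ-≡ 2 _ _ vertices-and-genus) ⟩
  8 + D + D              ≡⟨ cong (λ x → 8 + x + x) 2E≡D ⟨
  8 + 2 * E + 2 * E      ≡⟨ collect E ⟩
  4 * (2 + E)            ∎)
  where
    open ≡-Reasoning
    n = 11 + 8 * t
    h = 8 * suc t * suc t + suc t
    distribute : ∀ n F h → 4 * (n + F + 2 * h) ≡ 4 * n + 8 * h + 4 * F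
    distribute = solve-∀
    collect : ∀ E → 8 + 2 * E + 2 * E ≡ 4 * (2 + E)
    collect = solve-∀
    polynomial : ∀ t → 4 * (11 + 8 * t) + 8 * (8 * suc t * suc t + suc t) + 2 ≡ 8 + (11 + 8 * t) * (10 + 8 * t)
    polynomial = solve-∀
    vertices-and-genus : 4 * n + 8 * h + 2 ≡ 8 + D + 2
    vertices-and-genus = trans (polynomial t) (trans (cong (8 +_) (sym D+2≡)) (sym (+-assoc 8 D 2)))

module Embedding (t : ℕ) where
  open Construction t
  open FromBelow (KminusK2-toℕ n) rotationBelow

  embedding : QuadrangularEmbedding n (8 * suc t * suc t + suc t)
  embedding = rotation , quadrangular quadrangularℕ , genus-count t faces edges darts-count
    where
      G = KminusK2 n
      darts-count : length (darts G) + 2 ≡ (11 + 8 * t) * (10 + 8 * t)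
      darts-count = length-darts-KminusK2 m
      4≤darts : 4 ≤ length (darts G)
      4≤darts = +-cancelʳ-≤ 2 4 _ (subst (6 ≤_) (sym darts-count) (≤-trans (m≤m+n 6 _) (≤-reflexive (arithmetic t))))
        where arithmetic : ∀ t → 6 + (104 + 168 * t + 64 * t * t) ≡ (11 + 8 * t) * (10 + 8 * t)
              arithmetic = solve-∀
      faces = 4*numFaces≡length-darts G (λ {u} {v} → subst T (KminusK2-sym n u v)) rotation
                                      (quadrangular quadrangularℕ) 4≤darts
      edges = handshake G (KminusK2-sym n) (KminusK2-irrefl n)

lemma6 : (s : ℕ) → 1 ≤ s →
    Σ (Rotation (KminusK2 (8 * s + 3))) λ R →
      Quadrangular (KminusK2 (8 * s + 3)) R
        × InSurfaceOfGenus (KminusK2 (8 * s + 3)) R (8 * s * s + s)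
lemma6 (suc t) _ = subst (λ n → QuadrangularEmbedding n (8 * suc t * suc t + suc t)) (vertices t) (Embedding.embedding t)
  where vertices : ∀ t → 2 + (9 + 8 * t) ≡ 8 * suc t + 3
        vertices = solve-∀
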